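{- Consider an instance of UPR with minimum makespan $T^*$ and a time horizon $T\ge T^*$. Let $N_S\subseteq N_T$ contain $(v,0)$ and $(v,T)$ for all $v\in N$, let $D_S=(N_S,A_S\cup H_S)$ with capacities $u',b'$ be constructed from $N_S$ by the construction procedure below, and let $\hat x$ be an optimal solution of $\mathrm{UPR}(D_S)$. Then the augmentation procedure applied to $(D_S,\hat x)$ only adds timed nodes $(v,t)$ to $N_S$ with $t\le T^*+1$.
   Context: UPR: a directed graph $D=(N,A)$; each arc $vw\in A$ has transit time $\tau_{vw}\in\mathbb{N}$ and capacity $u_{vw}\in\mathbb{N}$; each node $v$ has storage capacity $b_v\in\mathbb{N}$; $\mathcal{K}$ is a finite set of packets with origin $s_k$ and destination $t_k$; $\mathcal{K}_v=\{k:s_k\ne v,t_k\ne v\}$ (packets active at $v$). Each packet is routed along a single trajectory over discrete times $0,1,2,\dots$ (at each integer time it either waits at a node or departs along an arc $vw$, arriving $\tau_{vw}$ later); at most $u_{vw}$ packets may depart along $vw$ at the same time and at most $b_v$ active packets may be held at $v$ at any time. The makespan is the latest arrival time of a packet at its destination; $T^*$ is the minimum makespan. For $T\in\mathbb{N}$: $N_T=\{(v,t):v\in N,0\le t\le T\}$, $A_T=\{((v,t),(w,t+\tau_{vw})):vw\in A,t+\tau_{vw}\le T\}$, and $\mathrm{UPR}(D_T)$ is the time-indexed integer program: binary $x^k_e$ on $A_T$ and holdover arcs $((v,t),(v,t+1))$, minimize $\bar T$ s.t. $t'x^k_e\le\bar T$ for movement arcs $e=((v,t),(w,t'))$; $\sum_{e=((v,t),(w,t'))\in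 A_T,w=t_k}t'x^k_e\le\bar T$; flow conservation from $(s_k,0)$ to $(t_k,T)$; arc capacities $u_{vw}$; storage $\sum_{k\in\mathcal{K}_v}x^k_e\le b_v$ on holdover arcs at $v$. For $N_S\subseteq N_T$: $\mathtt{n_S}(v,t)=\min\{t'>t:(v,t')\in N_S\}$, $\mathtt{m_S}(v,t)=\mathtt{n_S}(v,t)-t$ (defined for any $t$). Construction procedure: for each $(v,t)\in N_S$ with $t<T$ add holdover arc $e=((v,t),(v,\mathtt{n_S}(v,t)))$ to $H_S$; for each $(v,t)\in N_S$ and each $vw\in A$ add movement arc $f=((v,t),(w,t'))$ to $A_S$ with $t'$ the largest value with $(w,t')\in N_S$ and $t'\le t+\tau_{vw}$, with capacity $u'_f=u_{vw}\mathtt{m_S}(v,t)$. With $N^-_S(v,t)=\{(w,t'):((w,t'),(v,t))\in A_S\}$, $N^-_T(v,t)=\{(w,t'):((w,t'),(v,t))\in A_T\}$ and $U_e=\sum_{(w,t')\in N^-_T(v,t)\cup N^-_S(v,t)}u_{wv}(\mathtt{m_S}(w,t')-1)$, the holdover arc $e$ at $(v,t)$ gets $b'_e=b_v+U_e$ if $(v,t+1)\in N_S$ and $b'_e=2b_v+U_e$ otherwise. $\mathrm{UPR}(D_S)$: binary $x^k_e$ on $A_S\cup H_S$, minimize $\bar T$ s.t. $(t+\tau_{vw})x^k_e\le\bar T$ for $e=((v,t),(w,t'))\in A_S$; $\sum_{e=((v,t),(w,t'))\in A_S,w=t_k}(t+\tau_{vw})x^k_e\le\bar T$ for each $k$; flow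 conservation in $D_S$ from $(s_k,0)$ to $(t_k,T)$; $\sum_k x^k_e\le u'_e$ on $A_S$; $\sum_{k\in\mathcal{K}_v}x^k_e\le b'_e$ on holdover arcs at $v$. Augmentation procedure: for every arc $e=((v,t),(w,t'))$ of $A_S\cup H_S$ with $\hat x_e>0$ (where $\hat x_e=\sum_{k}\hat x^k_e$ for $e\in A_S$ and $\hat x_e=\sum_{k\in\mathcal{K}_v}\hat x^k_e$ for $e\in H_S$): if $e\in A_S$ and $t'<t+\tau_{vw}$, add $(w,t+\tau_{vw})$; if $e\in A_S$ and $\hat x_e>u_{vw}$, add $(v,t+1)$; if $e\in H_S$ and $\hat x_e>b_v$, add $(z,\bar t+1)$ for every $(z,\bar t)\in N^-_T(v,t)$ (so $\bar t=t-\tau_{zv}$) with $\mathtt{m_S}(z,\bar t)>1$, and add $(v,t+1)$. -}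

module Defs where

open import Data.Nat using (ℕ; zero; suc; _+_; _*_; _∸_; _≤_; _<_)
open import Data.Nat.Base using (_≤ᵇ_; _<ᵇ_; _≡ᵇ_)
open import Data.Bool using (Bool; true; false; if_then_else_; _∧_; _∨_; not)
open import Data.Fin using (Fin) renaming (_≟_ to _≟F_)
open import Data.List using (List; []; _∷_; map; upTo; allFin)
open import Data.Nat.ListAction using (sum)
open import Data.Product using (Σ; _×_; _,_; proj₁; proj₂)
open import Data.Maybe using (Maybe; just; nothing; fromMaybe)
open import Relation.Nullary.Decidable using (⌊_⌋)
open import Relation.Binary.PropositionalEquality using (_≡_)

-- A ⊆ N × N is given by the Boolean relation 'edge'
-- (so there are no parallel arcs and u_{vw}, τ_{vw} are well defined);
-- τ and u are only meaningful on arcs.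

record Instance : Set where
  field
    n    : ℕ
    edge : Fin n → Fin n → Bool
    τ    : Fin n → Fin n → ℕ
    u    : Fin n → Fin n → ℕ
    b    : Fin n → ℕ
    K    : ℕ
    src  : Fin K → Fin n
    dst  : Fin K → Fin n

χ : Bool → ℕ
χ true  = 1
χ false = 0

ΣT : ℕ → (ℕ → ℕ) → ℕ
ΣT T f = sum (map f (upTo (suc T)))

ΣF : ∀ {k} → (Fin k → ℕ) → ℕ
ΣF {k} f = sum (map f (allFin k))

module _ (I : Instance) where
  open Instance I

  _=F_ : Fin n → Fin n → Bool
  x =F y = ⌊ x ≟F y ⌋

  active : Fin K → Fin n → Bool
  active k v = not (src k =F v) ∧ not (dst k =F v)

  data Step : Set where
    wait : Step
    go   : Fin n → Step

  Trajectory : Set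
  Trajectory = List Step

  validTraj : Fin n → Trajectory → Bool
  validTraj v []         = true
  validTraj v (wait ∷ s) = validTraj v s
  validTraj v (go w ∷ s) = edge v w ∧ validTraj w s

  endpoint : Fin n → ℕ → Trajectory → Fin n × ℕ
  endpoint v t []         = v , t
  endpoint v t (wait ∷ s) = endpoint v (suc t) s
  endpoint v t (go w ∷ s) = endpoint w (t + τ v w) s

  departsAt : Fin n → ℕ → Trajectory → Fin n → Fin n → ℕ → Bool
  departsAt v t []         x y t' = false
  departsAt v t (wait ∷ s) x y t' = departsAt v (suc t) s x y t'
  departsAt v t (go w ∷ s) x y t' =
    ((v =F x) ∧ (w =F y) ∧ (t ≡ᵇ t')) ∨ departsAt w (t + τ v w) s x y t'

  waitsAt : Fin n → ℕ → Trajectory → Fin n → ℕ → Bool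
  waitsAt v t []         x t' = false
  waitsAt v t (wait ∷ s) x t' = ((v =F x) ∧ (t ≡ᵇ t')) ∨ waitsAt v (suc t) s x t'
  waitsAt v t (go w ∷ s) x t' = waitsAt w (t + τ v w) s x t'

  Routing : Set
  Routing = Fin K → Trajectory

  record FeasibleRouting (r : Routing) : Set where
    field
      valid    : ∀ k → validTraj (src k) (r k) ≡ true
      reaches  : ∀ k → proj₁ (endpoint (src k) 0 (r k)) ≡ dst k
      capacity : ∀ v w t →
                 ΣF (λ k → χ (departsAt (src k) 0 (r k) v w t)) ≤ u v w
      storage  : ∀ v t →
                 ΣF (λ k → χ (active k v ∧ waitsAt (src k) 0 (r k) v t)) ≤ b v

  arrival : Routing → Fin K → ℕ
  arrival r k = proj₂ (endpoint (src k) 0 (r k))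

  IsMinMakespan : ℕ → Set
  IsMinMakespan T* =
    Σ Routing (λ r → FeasibleRouting r × (∀ k → arrival r k ≤ T*))
    × (∀ r → FeasibleRouting r → (M : ℕ) → (∀ k → arrival r k ≤ M) → T* ≤ M)

  TimedSet : Set
  TimedSet = Fin n → ℕ → Bool

  findNext : TimedSet → Fin n → ℕ → ℕ → Maybe ℕ
  findNext S v zero    c = nothing
  findNext S v (suc f) c = if S v c then just c else findNext S v f (suc c)

  -- n_S(v,t) = min { t' > t : (v,t') ∈ N_S }  (searching t' ≤ T;
  -- convention: t+1 if there is none, which only happens for t ≥ T)
  nS : TimedSet → ℕ → Fin n → ℕ → ℕ
  nS S T v t = fromMaybe (suc t) (findNext S v (T ∸ t) (suc t))

  mS : TimedSet → ℕ → Fin n → ℕ → ℕ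
  mS S T v t = nS S T v t ∸ t

  -- largest t' ≤ x with (w,t') ∈ N_S  (0 if none; (w,0) ∈ N_S anyway)
  prevS : TimedSet → Fin n → ℕ → ℕ
  prevS S w zero    = zero
  prevS S w (suc x) = if S w (suc x) then suc x else prevS S w x

  -- arcs of D_S:  hold v t  = ((v,t),(v,n_S(v,t))) ∈ H_S,
  --               move v w t = ((v,t),(w,prevS w (t+τ_vw))) ∈ A_S
  data SArc : Set where
    hold : Fin n → ℕ → SArc
    move : Fin n → Fin n → ℕ → SArc

  inSArc : TimedSet → ℕ → SArc → Bool
  inSArc S T (hold v t)   = S v t ∧ (t <ᵇ T)
  inSArc S T (move v w t) = S v t ∧ edge v w

  uCap : TimedSet → ℕ → Fin n → Fin n → ℕ → ℕ
  uCap S T v w t = u v w * mS S T v t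

  inNT : Fin n → ℕ → Fin n → ℕ → Bool
  inNT v t w t' = edge w v ∧ (τ w v ≤ᵇ t) ∧ (t' ≡ᵇ (t ∸ τ w v))

  inNS : TimedSet → Fin n → ℕ → Fin n → ℕ → Bool
  inNS S v t w t' = edge w v ∧ S w t' ∧ (prevS S v (t' + τ w v) ≡ᵇ t)

  Ue : TimedSet → ℕ → Fin n → ℕ → ℕ
  Ue S T v t = ΣF (λ w → ΣT T (λ t' →
      χ (inNT v t w t' ∨ inNS S v t w t') * (u w v * (mS S T w t' ∸ 1))))

  bCap : TimedSet → ℕ → Fin n → ℕ → ℕ
  bCap S T v t = (if S v (suc t) then b v else 2 * b v) + Ue S T v t

  SSol : Set
  SSol = Fin K → SArc → Bool

  load : SSol → SArc → ℕ
  load x e = ΣF (λ k → χ (x k e))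

  loadH : SSol → Fin n → ℕ → ℕ
  loadH x v t = ΣF (λ k → χ (active k v ∧ x k (hold v t)))

  outflow : SSol → Fin K → Fin n → ℕ → ℕ
  outflow x k v t = χ (x k (hold v t)) + ΣF (λ w → χ (x k (move v w t)))

  inflow : TimedSet → ℕ → SSol → Fin K → Fin n → ℕ → ℕ
  inflow S T x k v t =
      ΣT T (λ t'' → χ (S v t'' ∧ (t'' <ᵇ T) ∧ (nS S T v t'' ≡ᵇ t) ∧ x k (hold v t'')))
    + ΣF (λ w → ΣT T (λ t'' →
        χ (S w t'' ∧ edge w v ∧ (prevS S v (t'' + τ w v) ≡ᵇ t) ∧ x k (move w v t''))))

  isSource : Fin K → Fin n → ℕ → ℕ
  isSource k v t = χ ((src k =F v) ∧ (t ≡ᵇ 0))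

  isSink : ℕ → Fin K → Fin n → ℕ → ℕ
  isSink T k v t = χ ((dst k =F v) ∧ (t ≡ᵇ T))

  record FeasibleS (S : TimedSet) (T : ℕ) (x : SSol) (Tbar : ℕ) : Set where
    field
      support  : ∀ k e → x k e ≡ true → inSArc S T e ≡ true
      flow     : ∀ k v t → S v t ≡ true →
                 outflow x k v t + isSink T k v t ≡ inflow S T x k v t + isSource k v t
      moveTime : ∀ k v w t → x k (move v w t) ≡ true → t + τ v w ≤ Tbar
      arrTime  : ∀ k → ΣF (λ v → ΣT T (λ t →
                   (t + τ v (dst k)) * χ (x k (move v (dst k) t)))) ≤ Tbar
      capacity : ∀ v w t → inSArc S T (move v w t) ≡ true →
                 load x (move v w t) ≤ uCap S T v w t
      storage  : ∀ v t → inSArc S T (hold v t) ≡ true →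
                 loadH x v t ≤ bCap S T v t

  OptimalS : TimedSet → ℕ → SSol → ℕ → Set
  OptimalS S T x Tbar =
    FeasibleS S T x Tbar × (∀ x' T' → FeasibleS S T x' T' → Tbar ≤ T')

  -- The augmentation procedure: Adds S T x z t means that the procedure
  -- applied to (D_S , x) prescribes adding the timed node (z,t).

  data Adds (S : TimedSet) (T : ℕ) (x : SSol) : Fin n → ℕ → Set where
    transit  : ∀ v w t → inSArc S T (move v w t) ≡ true →
               0 < load x (move v w t) →
               prevS S w (t + τ v w) < t + τ v w →
               Adds S T x w (t + τ v w)
    moveCap  : ∀ v w t → inSArc S T (move v w t) ≡ true →
               0 < load x (move v w t) →
               u v w < load x (move v w t) →
               Adds S T x v (suc t)
    holdSelf : ∀ v t → inSArc S T (hold v t) ≡ true →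
               0 < loadH x v t →
               b v < loadH x v t →
               Adds S T x v (suc t)
    holdPred : ∀ v t z → inSArc S T (hold v t) ≡ true →
               0 < loadH x v t →
               b v < loadH x v t →
               edge z v ≡ true → τ z v ≤ t →
               1 < mS S T z (t ∸ τ z v) →
               Adds S T x z (suc (t ∸ τ z v))

{-# OPTIONS --safe #-}
module Submission where

-- Let T̂ be the optimal value of UPR(D_S). Every node prescribed by the augmentation is either the arrival of a
-- used movement arc or at most one step after the start of a used arc. Used movement arcs arrive by T̂ (makespan
-- constraints), and used holdover arcs start before T̂: by flow conservation, a packet held at a node other than
-- its destination must later depart from it along a movement arc. Conversely UPR(D_S) is a relaxation of UPR: an
-- optimal routing, rounded down to the time points of N_S and with cycles erased, is feasible in D_S with makespan
-- T*, since every use of an arc of D_S can be charged to a departure or wait of the routing that the enlarged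
-- capacities u′ and b′ account for. So T̂ ≤ T*.

open import Defs
open import Data.Fin using (Fin) renaming (_≟_ to _≟ᶠ_)
open import Data.Nat using (ℕ; zero; suc; _+_; _*_; _∸_; _≤_; _<_; z≤n; s≤s; pred; _≤ᵇ_; _<ᵇ_; _≡ᵇ_)
open import Data.Nat.Properties
open import Data.Nat.ListAction using (sum)
open import Data.Nat.Tactic.RingSolver using (solve-∀)
open import Data.Bool using (Bool; true; false; T; if_then_else_; _∧_; _∨_; not)
open import Data.Maybe using (just; nothing)
open import Data.List using (List; []; _∷_; _++_; map; length; upTo; allFin)
open import Data.List.Properties using (length-upTo)
open import Data.List.Membership.Propositional using (_∈_; find; lose)
open import Data.List.Membership.Propositional.Properties using (∈-++⁻; ∈-upTo⁺; ∈-allFin)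
import Data.List.Membership.DecPropositional as DecMembership
open import Data.List.Relation.Unary.Any using (Any; here; there; any?)
import Data.List.Relation.Unary.All as All
open import Data.List.Relation.Unary.AllPairs using (_∷_)
open import Data.List.Relation.Unary.Unique.Propositional using (Unique)
open import Data.List.Relation.Unary.Unique.Propositional.Properties using (upTo⁺; allFin⁺)
open import Data.Product using (∃; _×_; _,_; proj₁; proj₂; uncurry)
open import Data.Product.Properties using (≡-dec)
open import Data.Sum using (_⊎_; inj₁; inj₂)
open import Data.Unit using (⊤; tt)
open import Data.Empty using (⊥; ⊥-elim)
open import Function using (_∘_)
open import Relation.Nullary using (¬_; yes; no)
open import Relation.Nullary.Decidable using (⌊_⌋)
open import Relation.Binary.Definitions using (DecidableEquality)
open import Relation.Binary.PropositionalEquality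

¬0<⇒≡0 : ∀ {n} → ¬ 0 < n → n ≡ 0
¬0<⇒≡0 ¬0<n = n≤0⇒n≡0 (≮⇒≥ ¬0<n)

true≢false : true ≢ false
true≢false ()

sumOver : {A : Set} → List A → (A → ℕ) → ℕ
sumOver L f = sum (map f L)

module _ {A : Set} where

  sumOver-mono-≤ : (L : List A) {f g : A → ℕ} → (∀ x → f x ≤ g x) → sumOver L f ≤ sumOver L g
  sumOver-mono-≤ []      f≤g = z≤n
  sumOver-mono-≤ (x ∷ L) f≤g = +-mono-≤ (f≤g x) (sumOver-mono-≤ L f≤g)

  sumOver-+ : (L : List A) (f g : A → ℕ) → sumOver L (λ x → f x + g x) ≡ sumOver L f + sumOver L g
  sumOver-+ []      f g = refl
  sumOver-+ (x ∷ L) f g = trans (cong (f x + g x +_) (sumOver-+ L f g)) (interchange (f x) (g x) _ _)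
    where
    interchange : ∀ a b c d → (a + b) + (c + d) ≡ (a + c) + (b + d)
    interchange = solve-∀

  sumOver-*ˡ : (L : List A) (c : ℕ) (f : A → ℕ) → sumOver L (λ x → c * f x) ≡ c * sumOver L f
  sumOver-*ˡ []      c f = sym (*-zeroʳ c)
  sumOver-*ˡ (x ∷ L) c f = trans (cong (c * f x +_) (sumOver-*ˡ L c f)) (sym (*-distribˡ-+ c (f x) _))

  sumOver-const : (L : List A) → sumOver L (λ _ → 0) ≡ 0
  sumOver-const []      = refl
  sumOver-const (_ ∷ L) = sumOver-const L

  sumOver-≤-length* : (L : List A) {f : A → ℕ} (c : ℕ) → (∀ x → f x ≤ c) → sumOver L f ≤ length L * c
  sumOver-≤-length* []      c f≤c = z≤n
  sumOver-≤-length* (x ∷ L) c f≤c = +-mono-≤ (f≤c x) (sumOver-≤-length* L c f≤c)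

  ∈⇒≤sumOver : (L : List A) (f : A → ℕ) {x : A} → x ∈ L → f x ≤ sumOver L f
  ∈⇒≤sumOver (y ∷ L) f (here refl) = m≤m+n (f y) _
  ∈⇒≤sumOver (y ∷ L) f (there x∈L) = ≤-trans (∈⇒≤sumOver L f x∈L) (m≤n+m _ (f y))

  sumOver-zero : (L : List A) (f : A → ℕ) → (∀ x → x ∈ L → f x ≡ 0) → sumOver L f ≡ 0
  sumOver-zero []      f f≡0 = refl
  sumOver-zero (x ∷ L) f f≡0 rewrite f≡0 x (here refl) = sumOver-zero L f (λ y y∈L → f≡0 y (there y∈L))

  sumOver-pos : (L : List A) (f : A → ℕ) → 0 < sumOver L f → ∃ λ x → x ∈ L × 0 < f x
  sumOver-pos []      f ()
  sumOver-pos (x ∷ L) f pos with f x in fx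
  ... | suc _ = x , here refl , subst (0 <_) (sym fx) (s≤s z≤n)
  ... | zero with sumOver-pos L f pos
  ...   | y , y∈L , fy = y , there y∈L , fy

  sumOver-≤-single : (L : List A) (f : A → ℕ) (M : ℕ) → Unique L → (∀ x → f x ≤ M) →
                     (∀ x y → 0 < f x → 0 < f y → x ≡ y) → sumOver L f ≤ M
  sumOver-≤-single []      f M _          f≤M single = z≤n
  sumOver-≤-single (x ∷ L) f M (x∉L ∷ uL) f≤M single with f x in fx
  ... | zero  = sumOver-≤-single L f M uL f≤M single
  ... | suc m = subst (_≤ M) (sym (trans (cong (suc m +_) rest≡0) (+-identityʳ (suc m)))) (subst (_≤ M) fx (f≤M x))
    where
    rest≡0 : sumOver L f ≡ 0
    rest≡0 = sumOver-zero L f λ y y∈L → ¬0<⇒≡0 (λ fy → All.lookup x∉L y∈L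
               (single x y (subst (0 <_) (sym fx) (s≤s z≤n)) fy))

sumOver-swap : {A B : Set} (L : List A) (M : List B) (f : A → B → ℕ) →
               sumOver L (λ x → sumOver M (f x)) ≡ sumOver M (λ y → sumOver L (λ x → f x y))
sumOver-swap []      M f = sym (sumOver-const M)
sumOver-swap (x ∷ L) M f = trans (cong (sumOver M (f x) +_) (sumOver-swap L M f))
                                 (sym (sumOver-+ M (f x) (λ y → sumOver L (λ x′ → f x′ y))))

∧-trueˡ : ∀ {a b} → a ∧ b ≡ true → a ≡ true
∧-trueˡ {true} _ = refl

∧-trueʳ : ∀ {a b} → a ∧ b ≡ true → b ≡ true
∧-trueʳ {true} b≡true = b≡true

∧-true : ∀ {a b} → a ≡ true → b ≡ true → a ∧ b ≡ true
∧-true refl refl = refl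

∨-trueˡ : ∀ {a b} → a ≡ true → a ∨ b ≡ true
∨-trueˡ refl = refl

∨-trueʳ : ∀ {a b} → b ≡ true → a ∨ b ≡ true
∨-trueʳ {true}  _ = refl
∨-trueʳ {false} b≡true = b≡true

T⇒≡true : ∀ {b} → T b → b ≡ true
T⇒≡true {true} _ = refl

≡true⇒T : ∀ {b} → b ≡ true → T b
≡true⇒T refl = tt

≡ᵇ-true⇒≡ : ∀ m n → (m ≡ᵇ n) ≡ true → m ≡ n
≡ᵇ-true⇒≡ m n eq = ≡ᵇ⇒≡ m n (≡true⇒T eq)

≡⇒≡ᵇ-true : ∀ m n → m ≡ n → (m ≡ᵇ n) ≡ true
≡⇒≡ᵇ-true m n eq = T⇒≡true (≡⇒≡ᵇ m n eq)

<ᵇ-true⇒< : ∀ m n → (m <ᵇ n) ≡ true → m < n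
<ᵇ-true⇒< m n lt = <ᵇ⇒< m n (≡true⇒T lt)

<⇒<ᵇ-true : ∀ {m n} → m < n → (m <ᵇ n) ≡ true
<⇒<ᵇ-true lt = T⇒≡true (<⇒<ᵇ lt)

≤⇒≤ᵇ-true : ∀ {m n} → m ≤ n → (m ≤ᵇ n) ≡ true
≤⇒≤ᵇ-true le = T⇒≡true (≤⇒≤ᵇ le)

χ-true : ∀ {b} → b ≡ true → χ b ≡ 1
χ-true refl = refl

χ-pos : ∀ b → 0 < χ b → b ≡ true
χ-pos true _ = refl

χ≤1 : ∀ b → χ b ≤ 1
χ≤1 true  = s≤s z≤n
χ≤1 false = z≤n

*χ-pos : ∀ a b → 0 < a * χ b → b ≡ true
*χ-pos a true  _   = refl
*χ-pos a false pos = ⊥-elim (<-irrefl (sym (*-zeroʳ a)) pos)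

sumOver-upTo-≤ : {A : Set} (L : List A) (m c : ℕ) (f : A → ℕ → ℕ) → (∀ j → sumOver L (λ x → f x j) ≤ c) →
                 sumOver L (λ x → sumOver (upTo m) (f x)) ≤ c * m
sumOver-upTo-≤ L m c f bound = begin
  sumOver L (λ x → sumOver (upTo m) (f x))       ≡⟨ sumOver-swap L (upTo m) f ⟩
  sumOver (upTo m) (λ j → sumOver L (λ x → f x j)) ≤⟨ sumOver-≤-length* (upTo m) c bound ⟩
  length (upTo m) * c                              ≡⟨ cong (_* c) (length-upTo m) ⟩
  m * c                                            ≡⟨ *-comm m c ⟩
  c * m                                            ∎
  where open ≤-Reasoning

-- Walks and cycle erasure

module Walks {Node Arc : Set} (_≟_ : DecidableEquality Node) (head tail : Arc → Node) where

  infixr 5 _∷ʷ_ _++ʷ_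

  data Walk : Node → Node → List Arc → Set where
    []ʷ  : ∀ {s} → Walk s s []
    _∷ʷ_ : ∀ {s e a L} → tail a ≡ s → Walk (head a) e L → Walk s e (a ∷ L)

  _++ʷ_ : ∀ {s m e L L′} → Walk s m L → Walk m e L′ → Walk s e (L ++ L′)
  []ʷ       ++ʷ w′ = w′
  (ta ∷ʷ w) ++ʷ w′ = ta ∷ʷ (w ++ʷ w′)

  Enters : Node → List Arc → Set
  Enters x = Any (λ a → head a ≡ x)

  Leaves : Node → List Arc → Set
  Leaves x = Any (λ a → tail a ≡ x)

  -- The heads of the arcs are pairwise distinct and differ from s.
  Simple : Node → List Arc → Set
  Simple s []      = ⊤
  Simple s (a ∷ L) = ¬ Enters s (a ∷ L) × Simple (head a) L

  _⊆_ : List Arc → List Arc → Set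
  L ⊆ M = ∀ {a} → a ∈ L → a ∈ M

  ¬Enters-⊆ : ∀ {s L M} → L ⊆ M → ¬ Enters s M → ¬ Enters s L
  ¬Enters-⊆ L⊆M ¬enters enters with find enters
  ... | a , a∈L , ha = ¬enters (lose (L⊆M a∈L) ha)

  afterLastVisit : Node → List Arc → List Arc
  afterLastVisit s []      = []
  afterLastVisit s (a ∷ L) with any? (λ b → head b ≟ s) L
  ... | yes _ = afterLastVisit s L
  ... | no _ with head a ≟ s
  ...   | yes _ = L
  ...   | no _  = a ∷ L

  afterLastVisit-⊆ : ∀ s L → afterLastVisit s L ⊆ L
  afterLastVisit-⊆ s []      a∈ = a∈
  afterLastVisit-⊆ s (a ∷ L) a∈ with any? (λ b → head b ≟ s) L
  ... | yes _ = there (afterLastVisit-⊆ s L a∈)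
  ... | no _ with head a ≟ s
  ...   | yes _ = there a∈
  ...   | no _  = a∈

  afterLastVisit-length : ∀ s L → length (afterLastVisit s L) ≤ length L
  afterLastVisit-length s []      = z≤n
  afterLastVisit-length s (a ∷ L) with any? (λ b → head b ≟ s) L
  ... | yes _ = ≤-trans (afterLastVisit-length s L) (n≤1+n _)
  ... | no _ with head a ≟ s
  ...   | yes _ = n≤1+n _
  ...   | no _  = ≤-refl

  afterLastVisit-¬Enters : ∀ s L → ¬ Enters s (afterLastVisit s L)
  afterLastVisit-¬Enters s []      ()
  afterLastVisit-¬Enters s (a ∷ L) with any? (λ b → head b ≟ s) L
  ... | yes _ = afterLastVisit-¬Enters s L
  ... | no ¬enters with head a ≟ s
  ...   | yes _  = ¬enters
  ...   | no ha≢s = λ { (here ha≡s) → ha≢s ha≡s ; (there enters) → ¬enters enters }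

  afterLastVisit-Walk : ∀ {x e L} s → Walk x e L → x ≡ s ⊎ Enters s L → Walk s e (afterLastVisit s L)
  afterLastVisit-Walk s []ʷ (inj₁ refl) = []ʷ
  afterLastVisit-Walk s []ʷ (inj₂ ())
  afterLastVisit-Walk {L = a ∷ L} s (ta ∷ʷ w) visits with any? (λ b → head b ≟ s) L
  ... | yes enters = afterLastVisit-Walk s w (inj₂ enters)
  ... | no ¬enters with head a ≟ s | visits
  ...   | yes refl   | _                = w
  ...   | no _       | inj₁ refl        = ta ∷ʷ w
  ...   | no ha≢s    | inj₂ (here ha≡s) = ⊥-elim (ha≢s ha≡s)
  ...   | no _       | inj₂ (there enters) = ⊥-elim (¬enters enters)

  -- Cycle erasure; the fuel length L always suffices since each round consumes an arc.
  private
    simplifyWith : ℕ → Node → List Arc → List Arc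
    simplifyWith zero    s L = []
    simplifyWith (suc f) s L with afterLastVisit s L
    ... | []     = []
    ... | a ∷ L′ = a ∷ simplifyWith f (head a) L′

    simplifyWith-⊆ : ∀ f s L → simplifyWith f s L ⊆ L
    simplifyWith-⊆ (suc f) s L a∈ with afterLastVisit s L | afterLastVisit-⊆ s L
    ... | a ∷ L′ | ⊆L with a∈
    ...   | here refl = ⊆L (here refl)
    ...   | there a∈′ = ⊆L (there (simplifyWith-⊆ f (head a) L′ a∈′))

    simplifyWith-Walk : ∀ f {s e L} → length L ≤ f → Walk s e L → Walk s e (simplifyWith f s L)
    simplifyWith-Walk zero    {L = []} _ []ʷ = []ʷ
    simplifyWith-Walk (suc f) {s} {e} {L} L≤f w
      with afterLastVisit s L | afterLastVisit-Walk s w (inj₁ refl) | afterLastVisit-length s L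
    ... | []     | []ʷ       | _ = []ʷ
    ... | a ∷ L′ | ta ∷ʷ w′ | ≤L = ta ∷ʷ simplifyWith-Walk f (≤-pred (≤-trans ≤L L≤f)) w′

    simplifyWith-Simple : ∀ f s L → Simple s (simplifyWith f s L)
    simplifyWith-Simple zero    s L = tt
    simplifyWith-Simple (suc f) s L with afterLastVisit s L | afterLastVisit-¬Enters s L
    ... | []     | _        = tt
    ... | a ∷ L′ | ¬enters =
      ¬Enters-⊆ (λ { (here refl) → here refl ; (there b∈) → there (simplifyWith-⊆ f (head a) L′ b∈) }) ¬enters ,
      simplifyWith-Simple f (head a) L′

  simplify : Node → List Arc → List Arc
  simplify s L = simplifyWith (length L) s L

  simplify-⊆ : ∀ s L → simplify s L ⊆ L
  simplify-⊆ s L = simplifyWith-⊆ (length L) s L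

  simplify-Walk : ∀ {s e L} → Walk s e L → Walk s e (simplify s L)
  simplify-Walk = simplifyWith-Walk _ ≤-refl

  simplify-Simple : ∀ s L → Simple s (simplify s L)
  simplify-Simple s L = simplifyWith-Simple (length L) s L

  Walk-tail : ∀ {s e L a} → Walk s e L → a ∈ L → tail a ≡ s ⊎ Enters (tail a) L
  Walk-tail (ta ∷ʷ w) (here refl) = inj₁ ta
  Walk-tail (ta ∷ʷ w) (there a∈) with Walk-tail w a∈
  ... | inj₁ ta≡hb = inj₂ (here (sym ta≡hb))
  ... | inj₂ enters = inj₂ (there enters)

  Walk-head : ∀ {s e L a} → Walk s e L → a ∈ L → head a ≡ e ⊎ Leaves (head a) L
  Walk-head (ta ∷ʷ []ʷ)        (here refl) = inj₁ refl
  Walk-head (ta ∷ʷ (tb ∷ʷ w)) (here refl) = inj₂ (there (here tb))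
  Walk-head (ta ∷ʷ w)          (there a∈) with Walk-head w a∈
  ... | inj₁ ha≡e   = inj₁ ha≡e
  ... | inj₂ leaves = inj₂ (there leaves)

  Walk-leaves : ∀ {s e L} → Walk s e L → s ≢ e → Leaves s L
  Walk-leaves []ʷ        s≢e = ⊥-elim (s≢e refl)
  Walk-leaves (ta ∷ʷ w) s≢e = here ta

  Walk-enters-∷ : ∀ {s e a L} → Walk s e (a ∷ L) → Enters e (a ∷ L)
  Walk-enters-∷ (_ ∷ʷ []ʷ)          = here refl
  Walk-enters-∷ (_ ∷ʷ w@(_ ∷ʷ _)) = there (Walk-enters-∷ w)

  Walk-enters : ∀ {s e L} → Walk s e L → s ≢ e → Enters e L
  Walk-enters []ʷ          s≢e = ⊥-elim (s≢e refl)
  Walk-enters w@(_ ∷ʷ _) _   = Walk-enters-∷ w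

  Walk-tail-∷ : ∀ {s e a b L} → Walk s e (b ∷ L) → a ∈ L → Enters (tail a) (b ∷ L)
  Walk-tail-∷ (_ ∷ʷ w) a∈ with Walk-tail w a∈
  ... | inj₁ ta≡hb  = here (sym ta≡hb)
  ... | inj₂ enters = there enters

  Simple-¬Enters-source : ∀ {s L} → Simple s L → ¬ Enters s L
  Simple-¬Enters-source {L = _ ∷ _} (¬enters , _) = ¬enters

  Simple-source : ∀ {s L a} → Simple s L → a ∈ L → head a ≢ s
  Simple-source simple a∈ ha≡s = Simple-¬Enters-source simple (lose a∈ ha≡s)

  Simple-head-injective : ∀ {s L a a′} → Simple s L → a ∈ L → a′ ∈ L → head a ≡ head a′ → a ≡ a′
  Simple-head-injective _                (here refl) (here refl) _  = refl
  Simple-head-injective (_ , simple)     (here refl) (there a′∈) eq = ⊥-elim (Simple-source simple a′∈ (sym eq))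
  Simple-head-injective (_ , simple)     (there a∈)  (here refl) eq = ⊥-elim (Simple-source simple a∈ eq)
  Simple-head-injective (_ , simple)     (there a∈)  (there a′∈) eq = Simple-head-injective simple a∈ a′∈ eq

  Simple-target : ∀ {s e L a} → Walk s e L → Simple s L → a ∈ L → tail a ≢ e
  Simple-target w@(ta ∷ʷ _) (¬enters , _) (here refl) ta≡e =
    ¬enters (subst (λ x → Enters x _) (trans (sym ta≡e) ta) (Walk-enters-∷ w))
  Simple-target (_ ∷ʷ w) (_ , simple) (there a∈) = Simple-target w simple a∈

  Simple-tail-injective : ∀ {s e L a a′} → Walk s e L → Simple s L → a ∈ L → a′ ∈ L → tail a ≡ tail a′ → a ≡ a′
  Simple-tail-injective _            _             (here refl) (here refl) _  = refl
  Simple-tail-injective w@(ta ∷ʷ _) (¬enters , _) (here refl) (there a′∈) eq =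
    ⊥-elim (¬enters (subst (λ x → Enters x _) (trans (sym eq) ta) (Walk-tail-∷ w a′∈)))
  Simple-tail-injective w@(ta ∷ʷ _) (¬enters , _) (there a∈)  (here refl) eq =
    ⊥-elim (¬enters (subst (λ x → Enters x _) (trans eq ta) (Walk-tail-∷ w a∈)))
  Simple-tail-injective (_ ∷ʷ w)    (_ , simple)  (there a∈)  (there a′∈) eq = Simple-tail-injective w simple a∈ a′∈ eq

  Simple-¬Leaves-target : ∀ {s e L} → Walk s e L → Simple s L → ¬ Leaves e L
  Simple-¬Leaves-target w simple leaves with find leaves
  ... | a , a∈ , ta≡e = Simple-target w simple a∈ ta≡e

  Walk-Leaves⇒Enters : ∀ {s e L p} → Walk s e L → p ≢ s → Leaves p L → Enters p L
  Walk-Leaves⇒Enters w p≢s leaves with find leaves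
  ... | a , a∈ , refl with Walk-tail w a∈
  ...   | inj₁ ta≡s   = ⊥-elim (p≢s ta≡s)
  ...   | inj₂ enters = enters

  Walk-Enters⇒Leaves : ∀ {s e L p} → Walk s e L → p ≢ e → Enters p L → Leaves p L
  Walk-Enters⇒Leaves w p≢e enters with find enters
  ... | a , a∈ , refl with Walk-head w a∈
  ...   | inj₁ ha≡e   = ⊥-elim (p≢e ha≡e)
  ...   | inj₂ leaves = leaves

-- Time points of N_S

module TimedSetFacts (I : Instance) (S : TimedSet I) (T : ℕ)
                     (S-0 : ∀ v → S v 0 ≡ true) (S-T : ∀ v → S v T ≡ true) where
  open Instance I

  next : Fin n → ℕ → ℕ
  next = nS I S T

  prev : Fin n → ℕ → ℕ
  prev = prevS I S

  private
    findNext-just : ∀ v f c c′ → findNext I S v f c ≡ just c′ →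
                    S v c′ ≡ true × c ≤ c′ × c′ < c + f × (∀ j → c ≤ j → j < c′ → S v j ≡ false)
    findNext-just v (suc f) c c′ found with S v c in Svc
    findNext-just v (suc f) c .c refl | true =
      Svc , ≤-refl , subst (c <_) (sym (+-suc c f)) (s≤s (m≤m+n c f)) ,
      λ j c≤j j<c → ⊥-elim (<-irrefl refl (≤-<-trans c≤j j<c))
    ... | false with findNext-just v f (suc c) c′ found
    ...   | Sc′ , c<c′ , c′< , gap = Sc′ , <⇒≤ c<c′ , subst (c′ <_) (sym (+-suc c f)) c′< , gap′
      where
      gap′ : ∀ j → c ≤ j → j < c′ → S v j ≡ false
      gap′ j c≤j j<c′ with c ≟ j
      ... | yes refl = Svc
      ... | no c≢j   = gap j (≤∧≢⇒< c≤j c≢j) j<c′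

    findNext-nothing : ∀ v f c → findNext I S v f c ≡ nothing → ∀ j → c ≤ j → j < c + f → S v j ≡ false
    findNext-nothing v zero c _ j c≤j j<c = ⊥-elim (<-irrefl refl (≤-<-trans c≤j (subst (j <_) (+-identityʳ c) j<c)))
    findNext-nothing v (suc f) c none j c≤j j< with S v c in Svc
    findNext-nothing v (suc f) c () j c≤j j< | true
    ... | false with c ≟ j
    ...   | yes refl = Svc
    ...   | no c≢j   = findNext-nothing v f (suc c) none j (≤∧≢⇒< c≤j c≢j) (subst (j <_) (+-suc c f) j<)

  t<next : ∀ v t → t < next v t
  t<next v t with findNext I S v (T ∸ t) (suc t) in found
  ... | nothing = ≤-refl
  ... | just _  = proj₁ (proj₂ (findNext-just v (T ∸ t) (suc t) _ found))

  next-gap : ∀ v t j → t < j → j < next v t → S v j ≡ false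
  next-gap v t j t<j j< with findNext I S v (T ∸ t) (suc t) in found
  ... | nothing = ⊥-elim (<-irrefl refl (≤-<-trans t<j j<))
  ... | just _  = proj₂ (proj₂ (proj₂ (findNext-just v (T ∸ t) (suc t) _ found))) j t<j j<

  next∈S : ∀ v t → t < T → S v (next v t) ≡ true × next v t ≤ T
  next∈S v t t<T with findNext I S v (T ∸ t) (suc t) in found
  ... | nothing = ⊥-elim (true≢false (trans (sym (S-T v)) (findNext-nothing v (T ∸ t) (suc t) found T t<T T<1+t+[T∸t])))
    where
    T<1+t+[T∸t] : T < suc t + (T ∸ t)
    T<1+t+[T∸t] = subst (T <_) (cong suc (sym (m+[n∸m]≡n (<⇒≤ t<T)))) ≤-refl
  ... | just c′ with findNext-just v (T ∸ t) (suc t) c′ found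
  ...   | Sc′ , _ , c′< , _ = Sc′ , subst (c′ ≤_) (m+[n∸m]≡n (<⇒≤ t<T)) (≤-pred c′<)

  next-least : ∀ v a b → S v b ≡ true → a < b → next v a ≤ b
  next-least v a b Svb a<b with next v a ≤? b
  ... | yes le = le
  ... | no ≰ with trans (sym Svb) (next-gap v a b a<b (≰⇒> ≰))
  ...   | ()

  prev≤ : ∀ v x → prev v x ≤ x
  prev≤ v zero    = z≤n
  prev≤ v (suc x) with S v (suc x)
  ... | true  = ≤-refl
  ... | false = ≤-trans (prev≤ v x) (n≤1+n x)

  prev∈S : ∀ v x → S v (prev v x) ≡ true
  prev∈S v zero    = S-0 v
  prev∈S v (suc x) with S v (suc x) in Sx
  ... | true  = Sx
  ... | false = prev∈S v x

  prev-gap : ∀ v x j → prev v x < j → j ≤ x → S v j ≡ false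
  prev-gap v zero    j p<j j≤x = ⊥-elim (<-irrefl refl (<-≤-trans p<j j≤x))
  prev-gap v (suc x) j p<j j≤x with S v (suc x) in Sx
  ... | true  = ⊥-elim (<-irrefl refl (<-≤-trans p<j j≤x))
  ... | false with j ≟ suc x
  ...   | yes refl = Sx
  ...   | no j≢    = prev-gap v x j p<j (≤-pred (≤∧≢⇒< j≤x j≢))

  prev-greatest : ∀ v x j → S v j ≡ true → j ≤ x → j ≤ prev v x
  prev-greatest v x j Svj j≤x with j ≤? prev v x
  ... | yes le = le
  ... | no ≰ with trans (sym Svj) (prev-gap v x j (≰⇒> ≰) j≤x)
  ...   | ()

  prev-mono : ∀ v {x y} → x ≤ y → prev v x ≤ prev v y
  prev-mono v {x} {y} x≤y = prev-greatest v y _ (prev∈S v x) (≤-trans (prev≤ v x) x≤y)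

  prev≡⇒<next : ∀ v t d → prev v d ≡ t → d ≤ T → d < next v t
  prev≡⇒<next v t d refl d≤T with d <? next v t
  ... | yes lt = lt
  ... | no ≮ = ⊥-elim (<-irrefl refl (≤-<-trans (prev-greatest v d _ (proj₁ (next∈S v t t<T)) (≮⇒≥ ≮)) (t<next v t)))
    where
    t<T : t < T
    t<T = <-≤-trans (t<next v t) (≤-trans (≮⇒≥ ≮) d≤T)

-- Nodes prescribed by the augmentation

active⇒dst≢ : ∀ (I : Instance) k v → active I k v ≡ true → _=F_ I (Instance.dst I k) v ≡ false
active⇒dst≢ I k v act with _=F_ I (Instance.dst I k) v | ∧-trueʳ {not (_=F_ I (Instance.src I k) v)} act
... | false | _ = refl

module AddedNodesBound (I : Instance) (S : TimedSet I) (T : ℕ)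
                       (S-0 : ∀ v → S v 0 ≡ true) (S-T : ∀ v → S v T ≡ true)
                       (x : SSol I) (T̂ : ℕ) (feasible : FeasibleS I S T x T̂) where
  open Instance I
  open TimedSetFacts I S T S-0 S-T
  open FeasibleS feasible

  load-pos : ∀ e → 0 < load I x e → ∃ λ k → x k e ≡ true
  load-pos e pos with sumOver-pos (allFin K) (λ k → χ (x k e)) pos
  ... | k , _ , xke = k , χ-pos _ xke

  loadH-pos : ∀ v t → 0 < loadH I x v t → ∃ λ k → active I k v ≡ true × x k (hold v t) ≡ true
  loadH-pos v t pos with sumOver-pos (allFin K) (λ k → χ (active I k v ∧ x k (hold v t))) pos
  ... | k , _ , used = k , ∧-trueˡ {active I k v} (χ-pos _ used) , ∧-trueʳ {active I k v} (χ-pos _ used)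

  held⇒<T : ∀ k v t → x k (hold v t) ≡ true → t < T
  held⇒<T k v t held = <ᵇ-true⇒< t T (∧-trueʳ {S v t} (support k (hold v t) held))

  held⇒outflow≥1 : ∀ k v t → x k (hold v t) ≡ true → active I k v ≡ true → 1 ≤ outflow I x k v (next v t)
  held⇒outflow≥1 k v t held act = begin
    1                                         ≤⟨ inflow≥1 ⟩
    inflow I S T x k v t₁                     ≤⟨ m≤m+n _ _ ⟩
    inflow I S T x k v t₁ + isSource I k v t₁ ≡⟨ sym (flow k v t₁ (proj₁ (next∈S v t t<T))) ⟩
    outflow I x k v t₁ + isSink I T k v t₁    ≡⟨ cong (outflow I x k v t₁ +_) noSink ⟩
    outflow I x k v t₁ + 0                    ≡⟨ +-identityʳ _ ⟩
    outflow I x k v t₁                        ∎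
    where
    open ≤-Reasoning
    t₁ = next v t
    inArc : (S v t ∧ (t <ᵇ T)) ≡ true
    inArc = support k (hold v t) held
    t<T : t < T
    t<T = held⇒<T k v t held
    holdTerm : ℕ → ℕ
    holdTerm t″ = χ (S v t″ ∧ (t″ <ᵇ T) ∧ (nS I S T v t″ ≡ᵇ t₁) ∧ x k (hold v t″))
    holdTerm≡1 : holdTerm t ≡ 1
    holdTerm≡1 = χ-true (∧-true (∧-trueˡ {S v t} inArc) (∧-true (∧-trueʳ {S v t} inArc) (∧-true (≡⇒≡ᵇ-true t₁ t₁ refl) held)))
    inflow≥1 : 1 ≤ inflow I S T x k v t₁
    inflow≥1 = ≤-trans (≤-trans (≤-reflexive (sym holdTerm≡1)) (∈⇒≤sumOver (upTo (suc T)) holdTerm (∈-upTo⁺ (s≤s (<⇒≤ t<T)))))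
                       (m≤m+n _ _)
    noSink : isSink I T k v t₁ ≡ 0
    noSink rewrite active⇒dst≢ I k v act = refl

  hold-continues : ∀ k v t → x k (hold v t) ≡ true → active I k v ≡ true →
                   x k (hold v (next v t)) ≡ true ⊎ ∃ λ w → x k (move v w (next v t)) ≡ true
  hold-continues k v t held act with x k (hold v (next v t)) in held′
  ... | true  = inj₁ refl
  ... | false with sumOver-pos (allFin n) (λ w → χ (x k (move v w (next v t))))
                     (subst (λ b → 1 ≤ χ b + ΣF (λ w → χ (x k (move v w (next v t))))) held′ (held⇒outflow≥1 k v t held act))
  ...   | w , _ , moved = inj₂ (w , χ-pos _ moved)

  held⇒<T̂ : ∀ fuel k v t → T ∸ t ≤ fuel → x k (hold v t) ≡ true → active I k v ≡ true → t < T̂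
  held⇒<T̂ fuel k v t T∸t≤fuel held act with hold-continues k v t held act | fuel
  ... | inj₂ (w , moved) | _ = <-≤-trans (t<next v t) (≤-trans (m≤m+n _ (τ v w)) (moveTime k v w (next v t) moved))
  ... | inj₁ _ | zero = ⊥-elim (<-irrefl refl (<-≤-trans (m<n⇒0<n∸m (held⇒<T k v t held)) T∸t≤fuel))
  ... | inj₁ held′ | suc f = <-trans (t<next v t) (held⇒<T̂ f k v (next v t) fuel′ held′ act)
    where
    fuel′ : T ∸ next v t ≤ f
    fuel′ = ≤-pred (<-≤-trans (∸-monoʳ-< (t<next v t) (proj₂ (next∈S v t (held⇒<T k v t held)))) T∸t≤fuel)

  loadH-pos⇒<T̂ : ∀ v t → 0 < loadH I x v t → t < T̂
  loadH-pos⇒<T̂ v t pos with loadH-pos v t pos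
  ... | k , act , held = held⇒<T̂ (T ∸ t) k v t ≤-refl held act

  added⇒≤1+T̂ : ∀ z t → Adds I S T x z t → t ≤ suc T̂
  added⇒≤1+T̂ z _ (transit v .z t _ pos _) with load-pos _ pos
  ... | k , moved = ≤-trans (moveTime k v z t moved) (n≤1+n T̂)
  added⇒≤1+T̂ z _ (moveCap .z w t _ pos _) with load-pos _ pos
  ... | k , moved = s≤s (≤-trans (m≤m+n t (τ z w)) (moveTime k z w t moved))
  added⇒≤1+T̂ z _ (holdSelf .z t _ pos _)           = <⇒≤ (s≤s (loadH-pos⇒<T̂ z t pos))
  added⇒≤1+T̂ z _ (holdPred v t .z _ pos _ _ _ _)   = <⇒≤ (s≤s (≤-<-trans (m∸n≤m t (τ z v)) (loadH-pos⇒<T̂ v t pos)))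

-- Embedding a routing into D_S

=F-refl : ∀ (I : Instance) v → _=F_ I v v ≡ true
=F-refl I v with v ≟ᶠ v
... | yes _ = refl
... | no v≢v = ⊥-elim (v≢v refl)

departsAt-here : ∀ (I : Instance) v w r s → departsAt I v r (go w ∷ s) v w r ≡ true
departsAt-here I v w r s = ∨-trueˡ (∧-true (=F-refl I v) (∧-true (=F-refl I w) (≡⇒≡ᵇ-true r r refl)))

waitsAt-here : ∀ (I : Instance) v r s → waitsAt I v r (wait ∷ s) v r ≡ true
waitsAt-here I v r s = ∨-trueˡ (∧-true (=F-refl I v) (≡⇒≡ᵇ-true r r refl))

endpoint-time-≥ : ∀ (I : Instance) v r s → r ≤ proj₂ (endpoint I v r s)
endpoint-time-≥ I v r []         = ≤-refl
endpoint-time-≥ I v r (wait ∷ s) = ≤-trans (n≤1+n r) (endpoint-time-≥ I v (suc r) s)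
endpoint-time-≥ I v r (go w ∷ s) = ≤-trans (m≤m+n r (Instance.τ I v w)) (endpoint-time-≥ I w _ s)

module Embedding (I : Instance) (S : TimedSet I) (T : ℕ)
                 (S-0 : ∀ v → S v 0 ≡ true) (S-T : ∀ v → S v T ≡ true)
                 (S≤T : ∀ v t → S v t ≡ true → t ≤ T) where
  open Instance I
  open TimedSetFacts I S T S-0 S-T public

  TimedNode : Set
  TimedNode = Fin n × ℕ

  _≟ᴺ_ : DecidableEquality TimedNode
  _≟ᴺ_ = ≡-dec _≟ᶠ_ _≟_

  arcHead : SArc I → TimedNode
  arcHead (hold v t)   = v , next v t
  arcHead (move v w t) = w , prev w (t + τ v w)

  arcTail : SArc I → TimedNode
  arcTail (hold v t)   = v , t
  arcTail (move v w t) = v , t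

  open Walks _≟ᴺ_ arcHead arcTail public

  private
    holdsWith : ℕ → Fin n → ℕ → ℕ → List (SArc I)
    holdsWith zero    v a b = []
    holdsWith (suc f) v a b with a <? b
    ... | yes _ = hold v a ∷ holdsWith f v (next v a) b
    ... | no _  = []

    holdsWith-Walk : ∀ f v a b → S v a ≡ true → S v b ≡ true → a ≤ b → b ≤ T → b ∸ a < f →
                     Walk (v , a) (v , b) (holdsWith f v a b)
    holdsWith-Walk (suc f) v a b Sa Sb a≤b b≤T b∸a<f with a <? b
    ... | yes a<b = refl ∷ʷ holdsWith-Walk f v (next v a) b (proj₁ (next∈S v a (<-≤-trans a<b b≤T))) Sb
                                (next-least v a b Sb a<b) b≤T
                                (<-≤-trans (∸-monoʳ-< (t<next v a) (next-least v a b Sb a<b)) (≤-pred b∸a<f))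
    ... | no a≮b with ≤-antisym a≤b (≮⇒≥ a≮b)
    ...   | refl = []ʷ

    holdsWith-arcs : ∀ f v a b h → S v a ≡ true → b ≤ T → h ∈ holdsWith f v a b →
                     ∃ λ t → h ≡ hold v t × a ≤ t × t < b × S v t ≡ true
    holdsWith-arcs (suc f) v a b h Sa b≤T h∈ with a <? b | h∈
    ... | yes a<b | here refl = a , refl , ≤-refl , a<b , Sa
    ... | yes a<b | there h∈′ with holdsWith-arcs f v (next v a) b h (proj₁ (next∈S v a (<-≤-trans a<b b≤T))) b≤T h∈′
    ...   | t , refl , next≤t , t<b , St = t , refl , <⇒≤ (<-≤-trans (t<next v a) next≤t) , t<b , St

  holds : Fin n → ℕ → ℕ → List (SArc I)
  holds v a b = holdsWith (suc b) v a b

  holds-Walk : ∀ v a b → S v a ≡ true → S v b ≡ true → a ≤ b → b ≤ T → Walk (v , a) (v , b) (holds v a b)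
  holds-Walk v a b Sa Sb a≤b b≤T = holdsWith-Walk (suc b) v a b Sa Sb a≤b b≤T (s≤s (m∸n≤m b a))

  holds-arcs : ∀ v a b h → S v a ≡ true → b ≤ T → h ∈ holds v a b →
               ∃ λ t → h ≡ hold v t × a ≤ t × t < b × S v t ≡ true
  holds-arcs v a b = holdsWith-arcs (suc b) v a b

  holds-only-holds : ∀ v a b {e} → e ∈ holds v a b → ∃ λ t → e ≡ hold v t
  holds-only-holds v a b = onlyHolds (suc b) a
    where
    onlyHolds : ∀ f a {e} → e ∈ holdsWith f v a b → ∃ λ t → e ≡ hold v t
    onlyHolds (suc f) a e∈ with a <? b | e∈
    ... | yes _ | here refl = a , refl
    ... | yes _ | there e∈′ = onlyHolds f (next v a) e∈′

  -- The arcs of D_S used by packet k that is at v at real time r, at the node (v , σ) of D_S, and then follows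
  -- the trajectory s; once at its destination it is held there until T.
  embed : Fin K → Fin n → ℕ → ℕ → Trajectory I → List (SArc I)
  embed k v r σ [] = holds v σ T
  embed k v r σ (wait ∷ s) with v ≟ᶠ dst k
  ... | yes _ = holds v σ T
  ... | no _  = holds v σ (prev v (suc r)) ++ embed k v (suc r) (prev v (suc r)) s
  embed k v r σ (go w ∷ s) with v ≟ᶠ dst k
  ... | yes _ = holds v σ T
  ... | no _  = holds v σ (prev v r) ++ (move v w (prev v r) ∷ embed k w (r + τ v w) (prev w (prev v r + τ v w)) s)

  embed-Walk : ∀ k s v r σ → S v σ ≡ true → σ ≤ prev v r →
               proj₁ (endpoint I v r s) ≡ dst k → proj₂ (endpoint I v r s) ≤ T →
               Walk (v , σ) (dst k , T) (embed k v r σ s)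
  embed-Walk k [] v r σ Sσ σ≤ refl r≤T = holds-Walk v σ T Sσ (S-T v) (≤-trans σ≤ (≤-trans (prev≤ v r) r≤T)) ≤-refl
  embed-Walk k (wait ∷ s) v r σ Sσ σ≤ reaches arrives with v ≟ᶠ dst k
  ... | yes refl = holds-Walk v σ T Sσ (S-T v) σ≤T ≤-refl
    where
    σ≤T = ≤-trans σ≤ (≤-trans (prev≤ v r) (≤-trans (n≤1+n r) (≤-trans (endpoint-time-≥ I v (suc r) s) arrives)))
  ... | no _ = holds-Walk v σ (prev v (suc r)) Sσ (prev∈S v (suc r)) (≤-trans σ≤ (prev-mono v (n≤1+n r)))
                 (S≤T v _ (prev∈S v (suc r)))
               ++ʷ embed-Walk k s v (suc r) (prev v (suc r)) (prev∈S v (suc r)) ≤-refl reaches arrives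
  embed-Walk k (go w ∷ s) v r σ Sσ σ≤ reaches arrives with v ≟ᶠ dst k
  ... | yes refl = holds-Walk v σ T Sσ (S-T v) σ≤T ≤-refl
    where
    σ≤T = ≤-trans σ≤ (≤-trans (prev≤ v r) (≤-trans (m≤m+n r (τ v w)) (≤-trans (endpoint-time-≥ I w _ s) arrives)))
  ... | no _ = holds-Walk v σ (prev v r) Sσ (prev∈S v r) σ≤ (S≤T v _ (prev∈S v r))
               ++ʷ refl ∷ʷ embed-Walk k s w (r + τ v w) (prev w (prev v r + τ v w)) (prev∈S w (prev v r + τ v w))
                             (prev-mono w (+-monoˡ-≤ (τ v w) (prev≤ v r))) reaches arrives

  IntoDst : Fin K → SArc I → Set
  IntoDst k (hold _ _)   = ⊥
  IntoDst k (move v w t) = w ≡ dst k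

  AtMostOneIntoDst : Fin K → List (SArc I) → Set
  AtMostOneIntoDst k L = ∀ {a a′} → a ∈ L → a′ ∈ L → IntoDst k a → IntoDst k a′ → a ≡ a′

  holds-¬IntoDst : ∀ k v a b {e} → e ∈ holds v a b → ¬ IntoDst k e
  holds-¬IntoDst k v a b e∈ with holds-only-holds v a b e∈
  ... | _ , refl = λ ()

  embed-dst-¬IntoDst : ∀ k s r σ {e} → e ∈ embed k (dst k) r σ s → ¬ IntoDst k e
  embed-dst-¬IntoDst k [] r σ = holds-¬IntoDst k (dst k) σ T
  embed-dst-¬IntoDst k (wait ∷ s) r σ with dst k ≟ᶠ dst k
  ... | yes _ = holds-¬IntoDst k (dst k) σ T
  ... | no d≢d = ⊥-elim (d≢d refl)
  embed-dst-¬IntoDst k (go w ∷ s) r σ with dst k ≟ᶠ dst k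
  ... | yes _ = holds-¬IntoDst k (dst k) σ T
  ... | no d≢d = ⊥-elim (d≢d refl)

  ++-AtMostOneIntoDst : ∀ k {L M} → (∀ {e} → e ∈ L → ¬ IntoDst k e) → AtMostOneIntoDst k M →
                        AtMostOneIntoDst k (L ++ M)
  ++-AtMostOneIntoDst k {L} none one e∈ e′∈ into into′ with ∈-++⁻ L e∈ | ∈-++⁻ L e′∈
  ... | inj₁ e∈L | _         = ⊥-elim (none e∈L into)
  ... | inj₂ _   | inj₁ e′∈L = ⊥-elim (none e′∈L into′)
  ... | inj₂ e∈M | inj₂ e′∈M = one e∈M e′∈M into into′

  embed-AtMostOneIntoDst : ∀ k s v r σ → AtMostOneIntoDst k (embed k v r σ s)
  embed-AtMostOneIntoDst k [] v r σ e∈ _ into _ = ⊥-elim (holds-¬IntoDst k v σ T e∈ into)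
  embed-AtMostOneIntoDst k (wait ∷ s) v r σ with v ≟ᶠ dst k
  ... | yes _ = λ e∈ _ into _ → ⊥-elim (holds-¬IntoDst k v σ T e∈ into)
  ... | no _  = ++-AtMostOneIntoDst k (holds-¬IntoDst k v σ _) (embed-AtMostOneIntoDst k s v (suc r) _)
  embed-AtMostOneIntoDst k (go w ∷ s) v r σ with v ≟ᶠ dst k
  ... | yes _ = λ e∈ _ into _ → ⊥-elim (holds-¬IntoDst k v σ T e∈ into)
  ... | no _  = ++-AtMostOneIntoDst k (holds-¬IntoDst k v σ _) one
    where
    rest = embed k w (r + τ v w) (prev w (prev v r + τ v w)) s
    one : AtMostOneIntoDst k (move v w (prev v r) ∷ rest)
    one (here refl) (here refl) _    _     = refl
    one (here refl) (there e′∈) refl into′ = ⊥-elim (embed-dst-¬IntoDst k s (r + τ v w) _ e′∈ into′)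
    one (there e∈)  (here refl) into refl  = ⊥-elim (embed-dst-¬IntoDst k s (r + τ v w) _ e∈ into)
    one (there e∈)  (there e′∈) into into′ = embed-AtMostOneIntoDst k s w (r + τ v w) _ e∈ e′∈ into into′

gap-offset : ∀ t′ d N → t′ < d → d < N → d ∸ suc t′ < (N ∸ t′) ∸ 1 × suc t′ + (d ∸ suc t′) ≡ d
gap-offset t′ d N t′<d d<N =
  subst (d ∸ suc t′ <_) (trans (cong (N ∸_) (+-comm 1 t′)) (sym (∸-+-assoc N t′ 1))) (∸-monoˡ-< d<N t′<d) ,
  m+[n∸m]≡n t′<d

module Witnesses (I : Instance) (S : TimedSet I) (T : ℕ)
                 (S-0 : ∀ v → S v 0 ≡ true) (S-T : ∀ v → S v T ≡ true)
                 (S≤T : ∀ v t → S v t ≡ true → t ≤ T)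
                 (k : Fin (Instance.K I)) (Dep : Fin (Instance.n I) → Fin (Instance.n I) → ℕ → Bool)
                 (Waits : Fin (Instance.n I) → ℕ → Bool) (T* : ℕ) (T*≤T : T* ≤ T) where
  open Instance I
  open Embedding I S T S-0 S-T S≤T

  InTransit : Fin n → ℕ → Set
  InTransit v t = ∃ λ w → ∃ λ t′ → ∃ λ j → (inNT I v t w t′ ∨ inNS I S v t w t′) ≡ true × t′ ≤ T ×
                  j < mS I S T w t′ ∸ 1 × Dep w v (suc t′ + j) ≡ true

  HoldReason : Fin n → ℕ → Set
  HoldReason v t = dst k ≡ v ⊎ Waits v (pred (next v t)) ≡ true ⊎ InTransit v t

  -- Each use of an arc of D_S is charged to an event of the routing that its capacity pays for: a move to a
  -- departure in [t , next v t), within u′ = u · m_S; a hold to the destination, to a wait just before next v t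
  -- (within b_v), or to a departure into v from inside a gap of N_S (within U_e).
  Witnessed : SArc I → Set
  Witnessed (hold v t)   = inSArc I S T (hold v t) ≡ true × HoldReason v t
  Witnessed (move v w t) = inSArc I S T (move v w t) ≡ true × t + τ v w ≤ T* ×
                           (∃ λ d → t ≤ d × d < next v t × Dep v w d ≡ true)

  -- How the copy (v , σ) of packet k in D_S lags behind its real position (v , r): σ is the last point of N_S at v
  -- up to r, or k has just arrived over wv, having departed at d from the node (w , σw) of D_S.
  data Position (v : Fin n) (r σ : ℕ) : Set where
    synced  : σ ≡ prev v r → Position v r σ
    arrived : (w : Fin n) (σw d : ℕ) → edge w v ≡ true → σw ≡ prev w d → r ≡ d + τ w v →
              σ ≡ prev v (σw + τ w v) → Dep w v d ≡ true → Position v r σ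

  inTransit-from-gap : ∀ v t w t′ d → (inNT I v t w t′ ∨ inNS I S v t w t′) ≡ true → t′ ≤ T →
                       t′ < d → d < next w t′ → Dep w v d ≡ true → InTransit v t
  inTransit-from-gap v t w t′ d into t′≤T t′<d d<next dep with gap-offset t′ d (next w t′) t′<d d<next
  ... | j< , t′+j≡d = w , t′ , d ∸ suc t′ , into , t′≤T , j< , subst (λ d′ → Dep w v d′ ≡ true) (sym t′+j≡d) dep

  arrival-late⇒InTransit : ∀ v w σw d t → edge w v ≡ true → σw ≡ prev w d → d + τ w v ≤ T →
                           prev v (σw + τ w v) ≤ t → S v t ≡ true → next v t ≤ d + τ w v →
                           Dep w v d ≡ true → InTransit v t
  arrival-late⇒InTransit v w σw d t wv σw≡ d+τ≤T prev≤t Svt next≤ dep with σw + τ w v ≤? t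
  ... | yes σw+τ≤t = inTransit-from-gap v t w t′ d viaNT t′≤T t′<d d<next dep
    where
    τ≤t = ≤-trans (m≤n+m (τ w v) σw) σw+τ≤t
    t′ = t ∸ τ w v
    viaNT : (inNT I v t w t′ ∨ inNS I S v t w t′) ≡ true
    viaNT = ∨-trueˡ (∧-true wv (∧-true (≤⇒≤ᵇ-true τ≤t) (≡⇒≡ᵇ-true t′ t′ refl)))
    t′≤T : t′ ≤ T
    t′≤T = ≤-trans (m∸n≤m t (τ w v)) (S≤T v t Svt)
    t′<d : t′ < d
    t′<d = +-cancelʳ-< (τ w v) t′ d (subst (_< d + τ w v) (sym (m∸n+n≡m τ≤t)) (<-≤-trans (t<next v t) next≤))
    d<next : d < next w t′
    d<next with d <? next w t′
    ... | yes lt = lt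
    ... | no ≮ = ⊥-elim (<-irrefl refl (<-≤-trans (t<next w t′) (≤-trans next≤σw (m+n≤o⇒m≤o∸n σw σw+τ≤t))))
      where
      t′<T : t′ < T
      t′<T = <-≤-trans (t<next w t′) (≤-trans (≮⇒≥ ≮) (≤-trans (m≤m+n d (τ w v)) d+τ≤T))
      next≤σw : next w t′ ≤ σw
      next≤σw = subst (next w t′ ≤_) (sym σw≡) (prev-greatest w d _ (proj₁ (next∈S w t′ t′<T)) (≮⇒≥ ≮))
  ... | no σw+τ≰t = inTransit-from-gap v t w σw d viaNS σw≤T σw<d d<next dep
    where
    prev≡t : prev v (σw + τ w v) ≡ t
    prev≡t = ≤-antisym prev≤t (prev-greatest v _ t Svt (<⇒≤ (≰⇒> σw+τ≰t)))
    viaNS : (inNT I v t w σw ∨ inNS I S v t w σw) ≡ true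
    viaNS = ∨-trueʳ {inNT I v t w σw} (∧-true wv (∧-true (subst (λ z → S w z ≡ true) (sym σw≡) (prev∈S w d)) (≡⇒≡ᵇ-true _ _ prev≡t)))
    σw≤d : σw ≤ d
    σw≤d = subst (_≤ d) (sym σw≡) (prev≤ w d)
    d≤T : d ≤ T
    d≤T = ≤-trans (m≤m+n d (τ w v)) d+τ≤T
    σw≤T = ≤-trans σw≤d d≤T
    σw<d : σw < d
    σw<d = ≤∧≢⇒< σw≤d λ { refl → <-irrefl refl (<-≤-trans (prev≡⇒<next v t (σw + τ w v) prev≡t d+τ≤T) next≤) }
    d<next : d < next w σw
    d<next = prev≡⇒<next w σw d (sym σw≡) d≤T

  behind⇒InTransit : ∀ v r σ t → Position v r σ → r ≤ T → σ ≤ t → S v t ≡ true → next v t ≤ r → InTransit v t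
  behind⇒InTransit v r σ t (synced σ≡) r≤T σ≤t Svt next≤r = ⊥-elim (<-irrefl refl (<-≤-trans (prev≡⇒<next v t r prev≡t r≤T) next≤r))
    where
    prev≡t : prev v r ≡ t
    prev≡t = ≤-antisym (subst (_≤ t) σ≡ σ≤t) (prev-greatest v r t Svt (<⇒≤ (<-≤-trans (t<next v t) next≤r)))
  behind⇒InTransit v r σ t (arrived w σw d wv σw≡ refl σ≡ dep) r≤T σ≤t Svt next≤r =
    arrival-late⇒InTransit v w σw d t wv σw≡ r≤T (subst (_≤ t) σ≡ σ≤t) Svt next≤r dep

  holds-Witnessed : ∀ v a b → S v a ≡ true → b ≤ T →
                    (∀ t → a ≤ t → t < b → S v t ≡ true → HoldReason v t) →
                    ∀ {e} → e ∈ holds v a b → Witnessed e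
  holds-Witnessed v a b Sa b≤T reason e∈ with holds-arcs v a b _ Sa b≤T e∈
  ... | t , refl , a≤t , t<b , St = ∧-true St (<⇒<ᵇ-true (<-≤-trans t<b b≤T)) , reason t a≤t t<b St

  waiting-HoldReason : ∀ v r σ → Waits v r ≡ true → Position v r σ → r ≤ T →
                       ∀ t → σ ≤ t → t < prev v (suc r) → S v t ≡ true → HoldReason v t
  waiting-HoldReason v r σ waits pos r≤T t σ≤t t<prev Svt with next v t ≟ suc r
  ... | yes next≡ = inj₂ (inj₁ (subst (λ z → Waits v (pred z) ≡ true) (sym next≡) waits))
  ... | no next≢  = inj₂ (inj₂ (behind⇒InTransit v r σ t pos r≤T σ≤t Svt (≤-pred (≤∧≢⇒< next≤1+r next≢))))
    where
    next≤1+r = ≤-trans (next-least v t _ (prev∈S v (suc r)) t<prev) (prev≤ v (suc r))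

  departing-HoldReason : ∀ v r σ → Position v r σ → r ≤ T →
                         ∀ t → σ ≤ t → t < prev v r → S v t ≡ true → HoldReason v t
  departing-HoldReason v r σ pos r≤T t σ≤t t<prev Svt =
    inj₂ (inj₂ (behind⇒InTransit v r σ t pos r≤T σ≤t Svt (≤-trans (next-least v t _ (prev∈S v r) t<prev) (prev≤ v r))))

  departure-Witnessed : ∀ v w r → edge v w ≡ true → r + τ v w ≤ T* → Dep v w r ≡ true → Witnessed (move v w (prev v r))
  departure-Witnessed v w r vw r+τ≤T* dep =
    ∧-true (prev∈S v r) vw , ≤-trans (+-monoˡ-≤ (τ v w) (prev≤ v r)) r+τ≤T* ,
    r , prev≤ v r , prev≡⇒<next v (prev v r) r refl r≤T , dep
    where
    r≤T = ≤-trans (m≤m+n r (τ v w)) (≤-trans r+τ≤T* T*≤T)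

  DeparturesIncluded : Fin n → ℕ → Trajectory I → Set
  DeparturesIncluded v r s = ∀ x y t → departsAt I v r s x y t ≡ true → Dep x y t ≡ true

  WaitsIncluded : Fin n → ℕ → Trajectory I → Set
  WaitsIncluded v r s = ∀ x t → waitsAt I v r s x t ≡ true → Waits x t ≡ true

  embed-Witnessed : ∀ s v r σ → DeparturesIncluded v r s → WaitsIncluded v r s →
                    S v σ ≡ true → validTraj I v s ≡ true →
                    proj₁ (endpoint I v r s) ≡ dst k → proj₂ (endpoint I v r s) ≤ T* → Position v r σ →
                    ∀ {e} → e ∈ embed k v r σ s → Witnessed e
  embed-Witnessed [] v r σ _ _ Sσ _ reaches _ _ =
    holds-Witnessed v σ T Sσ ≤-refl (λ _ _ _ _ → inj₁ (sym reaches))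
  embed-Witnessed (wait ∷ s) v r σ deps waits Sσ valid reaches arrives pos e∈ with v ≟ᶠ dst k
  ... | yes v≡dst = holds-Witnessed v σ T Sσ ≤-refl (λ _ _ _ _ → inj₁ (sym v≡dst)) e∈
  ... | no _ with ∈-++⁻ (holds v σ (prev v (suc r))) e∈
  ...   | inj₁ e∈holds = holds-Witnessed v σ _ Sσ (S≤T v _ (prev∈S v (suc r)))
                           (waiting-HoldReason v r σ (waits v r (waitsAt-here I v r s)) pos r≤T) e∈holds
    where
    r≤T = ≤-trans (≤-trans (n≤1+n r) (endpoint-time-≥ I v (suc r) s)) (≤-trans arrives T*≤T)
  ...   | inj₂ e∈rest = embed-Witnessed s v (suc r) (prev v (suc r)) deps (λ x t w → waits x t (∨-trueʳ w))
                          (prev∈S v (suc r)) valid reaches arrives (synced refl) e∈rest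
  embed-Witnessed (go w ∷ s) v r σ deps waits Sσ valid reaches arrives pos e∈ with v ≟ᶠ dst k
  ... | yes v≡dst = holds-Witnessed v σ T Sσ ≤-refl (λ _ _ _ _ → inj₁ (sym v≡dst)) e∈
  ... | no _ with ∈-++⁻ (holds v σ (prev v r)) e∈
  ...   | inj₁ e∈holds = holds-Witnessed v σ _ Sσ (S≤T v _ (prev∈S v r)) (departing-HoldReason v r σ pos r≤T) e∈holds
    where
    r≤T = ≤-trans (≤-trans (m≤m+n r (τ v w)) (endpoint-time-≥ I w _ s)) (≤-trans arrives T*≤T)
  ...   | inj₂ (here refl) = departure-Witnessed v w r (∧-trueˡ {edge v w} valid)
                               (≤-trans (endpoint-time-≥ I w _ s) arrives) (deps v w r (departsAt-here I v w r s))
  ...   | inj₂ (there e∈rest) =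
    embed-Witnessed s w (r + τ v w) (prev w (prev v r + τ v w)) (λ x y t d → deps x y t (∨-trueʳ d)) waits
      (prev∈S w (prev v r + τ v w)) (∧-trueʳ {edge v w} valid) reaches arrives
      (arrived v (prev v r) r (∧-trueˡ {edge v w} valid) refl refl refl (deps v w r (departsAt-here I v w r s))) e∈rest

-- UPR(D_S) is a relaxation of UPR

module _ {I : Instance} where
  open Instance I

  _≟ᴬ_ : DecidableEquality (SArc I)
  hold v t ≟ᴬ hold v′ t′ with v ≟ᶠ v′ | t ≟ t′
  ... | yes refl | yes refl = yes refl
  ... | no v≢    | _        = no λ { refl → v≢ refl }
  ... | _        | no t≢    = no λ { refl → t≢ refl }
  hold _ _ ≟ᴬ move _ _ _ = no λ ()
  move _ _ _ ≟ᴬ hold _ _ = no λ ()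
  move v w t ≟ᴬ move v′ w′ t′ with v ≟ᶠ v′ | w ≟ᶠ w′ | t ≟ t′
  ... | yes refl | yes refl | yes refl = yes refl
  ... | no v≢    | _        | _        = no λ { refl → v≢ refl }
  ... | _        | no w≢    | _        = no λ { refl → w≢ refl }
  ... | _        | _        | no t≢    = no λ { refl → t≢ refl }

  hold≢move : ∀ {v t v′ w t′} → hold {I} v t ≢ move v′ w t′
  hold≢move ()

  arcTime : SArc I → ℕ
  arcTime (hold _ t)   = t
  arcTime (move _ _ t) = t

  arcFrom : SArc I → Fin n
  arcFrom (hold v _)   = v
  arcFrom (move v _ _) = v

module Relaxation (I : Instance) (S : TimedSet I) (T : ℕ)
                  (S-0 : ∀ v → S v 0 ≡ true) (S-T : ∀ v → S v T ≡ true)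
                  (S≤T : ∀ v t → S v t ≡ true → t ≤ T)
                  (T* : ℕ) (T*≤T : T* ≤ T) (routing : Routing I) (feasible : FeasibleRouting I routing)
                  (arrival≤T* : ∀ k → arrival I routing k ≤ T*) where
  open Instance I
  open Embedding I S T S-0 S-T S≤T
  open DecMembership (_≟ᴬ_ {I}) using (_∈?_)
  open FeasibleRouting feasible

  Dep : Fin K → Fin n → Fin n → ℕ → Bool
  Dep k = departsAt I (src k) 0 (routing k)

  Waits : Fin K → Fin n → ℕ → Bool
  Waits k = waitsAt I (src k) 0 (routing k)

  module OfPacket (k : Fin K) = Witnesses I S T S-0 S-T S≤T k (Dep k) (Waits k) T* T*≤T

  trail : Fin K → List (SArc I)
  trail k = embed k (src k) 0 0 (routing k)

  -- Cycles must be erased: flow conservation in D_S is an equation, so a packet may pass each timed node only once.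
  path : Fin K → List (SArc I)
  path k = simplify (src k , 0) (trail k)

  x̂ : SSol I
  x̂ k e = ⌊ e ∈? path k ⌋

  path-Witnessed : ∀ k {e} → e ∈ path k → OfPacket.Witnessed k e
  path-Witnessed k e∈ =
    OfPacket.embed-Witnessed k (routing k) (src k) 0 0 (λ _ _ _ d → d) (λ _ _ w → w) (S-0 (src k))
      (valid k) (reaches k) (arrival≤T* k) (OfPacket.synced refl) (simplify-⊆ (src k , 0) (trail k) e∈)

  path-Walk : ∀ k → Walk (src k , 0) (dst k , T) (path k)
  path-Walk k = simplify-Walk {L = trail k} (embed-Walk k (routing k) (src k) 0 0 (S-0 (src k)) z≤n (reaches k) (≤-trans (arrival≤T* k) T*≤T))

  path-Simple : ∀ k → Simple (src k , 0) (path k)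
  path-Simple k = simplify-Simple (src k , 0) (trail k)

  path-AtMostOneIntoDst : ∀ k → AtMostOneIntoDst k (path k)
  path-AtMostOneIntoDst k e∈ e′∈ = embed-AtMostOneIntoDst k (routing k) (src k) 0 0 (simplify-⊆ (src k , 0) (trail k) e∈) (simplify-⊆ (src k , 0) (trail k) e′∈)

  x̂-true⇒∈ : ∀ k e → x̂ k e ≡ true → e ∈ path k
  x̂-true⇒∈ k e used with e ∈? path k
  ... | yes e∈ = e∈

  ∈⇒x̂-true : ∀ k e → e ∈ path k → x̂ k e ≡ true
  ∈⇒x̂-true k e e∈ with e ∈? path k
  ... | yes _  = refl
  ... | no e∉ = ⊥-elim (e∉ e∈)

  x̂-support : ∀ k e → x̂ k e ≡ true → inSArc I S T e ≡ true
  x̂-support k (hold v t)   used = proj₁ (path-Witnessed k (x̂-true⇒∈ k (hold v t) used))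
  x̂-support k (move v w t) used = proj₁ (path-Witnessed k (x̂-true⇒∈ k (move v w t) used))

  x̂-moveTime : ∀ k v w t → x̂ k (move v w t) ≡ true → t + τ v w ≤ T*
  x̂-moveTime k v w t used = proj₁ (proj₂ (path-Witnessed k (x̂-true⇒∈ k (move v w t) used)))

  x̂-arrTime : ∀ k → ΣF (λ v → ΣT T (λ t → (t + τ v (dst k)) * χ (x̂ k (move v (dst k) t)))) ≤ T*
  x̂-arrTime k = sumOver-≤-single (allFin n) (λ v → ΣT T (term v)) T* (allFin⁺ n) termSum≤T* sameNode
    where
    term : Fin n → ℕ → ℕ
    term v t = (t + τ v (dst k)) * χ (x̂ k (move v (dst k) t))
    term≤T* : ∀ v t → term v t ≤ T*
    term≤T* v t with x̂ k (move v (dst k) t) in used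
    ... | true  = subst (_≤ T*) (sym (*-identityʳ _)) (x̂-moveTime k v (dst k) t used)
    ... | false = subst (_≤ T*) (sym (*-zeroʳ (t + τ v (dst k)))) z≤n
    term-pos⇒∈ : ∀ v t → 0 < term v t → move v (dst k) t ∈ path k
    term-pos⇒∈ v t pos = x̂-true⇒∈ k _ (*χ-pos (t + τ v (dst k)) _ pos)
    sameArc : ∀ {v v′ t t′} → 0 < term v t → 0 < term v′ t′ → move v (dst k) t ≡ move v′ (dst k) t′
    sameArc pos pos′ = path-AtMostOneIntoDst k (term-pos⇒∈ _ _ pos) (term-pos⇒∈ _ _ pos′) refl refl
    termSum≤T* : ∀ v → ΣT T (term v) ≤ T*
    termSum≤T* v = sumOver-≤-single (upTo (suc T)) (term v) T* (upTo⁺ (suc T)) (term≤T* v)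
                     (λ t t′ pos pos′ → cong arcTime (sameArc {v} {v} {t} {t′} pos pos′))
    sameNode : ∀ v v′ → 0 < ΣT T (term v) → 0 < ΣT T (term v′) → v ≡ v′
    sameNode v v′ pos pos′ with sumOver-pos (upTo (suc T)) (term v) pos | sumOver-pos (upTo (suc T)) (term v′) pos′
    ... | t , _ , termPos | t′ , _ , termPos′ = cong arcFrom (sameArc {v} {v′} {t} {t′} termPos termPos′)

  x̂-capacity : ∀ v w t → load I x̂ (move v w t) ≤ uCap I S T v w t
  x̂-capacity v w t = ≤-trans (sumOver-mono-≤ (allFin K) charge)
                       (sumOver-upTo-≤ (allFin K) m (u v w) departures (λ j → capacity v w (t + j)))
    where
    m = mS I S T v t
    departures : Fin K → ℕ → ℕ
    departures k j = χ (Dep k v w (t + j))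
    charge : ∀ k → χ (x̂ k (move v w t)) ≤ sumOver (upTo m) (departures k)
    charge k with x̂ k (move v w t) in used
    ... | false = z≤n
    ... | true with proj₂ (proj₂ (path-Witnessed k (x̂-true⇒∈ k _ used)))
    ...   | d , t≤d , d<next , dep =
      ≤-trans (≤-reflexive (sym (χ-true (subst (λ z → Dep k v w z ≡ true) (sym (m+[n∸m]≡n t≤d)) dep))))
              (∈⇒≤sumOver (upTo m) (departures k) (∈-upTo⁺ (∸-monoˡ-< d<next t≤d)))

  module Storage (v : Fin n) (t : ℕ) where
    counted : Fin n → ℕ → ℕ
    counted w t′ = χ (inNT I v t w t′ ∨ inNS I S v t w t′)

    gap : Fin n → ℕ → ℕ
    gap w t′ = mS I S T w t′ ∸ 1

    departuresInGap : Fin K → Fin n → ℕ → ℕ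
    departuresInGap k w t′ = sumOver (upTo (gap w t′)) (λ j → χ (Dep k w v (suc t′ + j)))

    waiting : Fin K → ℕ
    waiting k = χ (active I k v ∧ Waits k v (pred (next v t)))

    inTransit : Fin K → ℕ
    inTransit k = ΣF (λ w → ΣT T (λ t′ → counted w t′ * departuresInGap k w t′))

    inTransit-pos : ∀ k → OfPacket.InTransit k v t → 1 ≤ inTransit k
    inTransit-pos k (w , t′ , j , into , t′≤T , j<gap , dep) = begin
      1                                       ≡⟨ sym (χ-true dep) ⟩
      χ (Dep k w v (suc t′ + j))              ≤⟨ ∈⇒≤sumOver (upTo (gap w t′)) _ (∈-upTo⁺ j<gap) ⟩
      departuresInGap k w t′                  ≡⟨ sym (*-identityˡ _) ⟩
      1 * departuresInGap k w t′              ≡⟨ cong (_* departuresInGap k w t′) (sym (χ-true into)) ⟩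
      counted w t′ * departuresInGap k w t′   ≤⟨ ∈⇒≤sumOver (upTo (suc T)) (λ t″ → counted w t″ * departuresInGap k w t″) (∈-upTo⁺ (s≤s t′≤T)) ⟩
      ΣT T (λ t″ → counted w t″ * departuresInGap k w t″)
                                              ≤⟨ ∈⇒≤sumOver (allFin n) (λ w′ → ΣT T (λ t″ → counted w′ t″ * departuresInGap k w′ t″)) (∈-allFin w) ⟩
      inTransit k                             ∎
      where open ≤-Reasoning

    charge : ∀ k → χ (active I k v ∧ x̂ k (hold v t)) ≤ waiting k + inTransit k
    charge k with active I k v in act | x̂ k (hold v t) in used
    ... | false | _     = z≤n
    ... | true  | false = z≤n
    ... | true  | true with proj₂ (path-Witnessed k (x̂-true⇒∈ k _ used))
    ...   | inj₁ refl = ⊥-elim (true≢false (trans (sym (=F-refl I v)) (active⇒dst≢ I k v act)))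
    ...   | inj₂ (inj₁ waits) rewrite waits = s≤s z≤n
    ...   | inj₂ (inj₂ travelling) = ≤-trans (inTransit-pos k travelling) (m≤n+m _ _)

    inTransit≤Ue : sumOver (allFin K) inTransit ≤ Ue I S T v t
    inTransit≤Ue = begin
      sumOver (allFin K) inTransit
        ≡⟨ sumOver-swap (allFin K) (allFin n) _ ⟩
      ΣF (λ w → sumOver (allFin K) (λ k → ΣT T (λ t′ → counted w t′ * departuresInGap k w t′)))
        ≤⟨ sumOver-mono-≤ (allFin n) (λ w → ≤-reflexive (sumOver-swap (allFin K) (upTo (suc T)) _)) ⟩
      ΣF (λ w → ΣT T (λ t′ → sumOver (allFin K) (λ k → counted w t′ * departuresInGap k w t′)))
        ≤⟨ sumOver-mono-≤ (allFin n) (λ w → sumOver-mono-≤ (upTo (suc T)) λ t′ →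
             ≤-reflexive (sumOver-*ˡ (allFin K) (counted w t′) _)) ⟩
      ΣF (λ w → ΣT T (λ t′ → counted w t′ * sumOver (allFin K) (λ k → departuresInGap k w t′)))
        ≤⟨ sumOver-mono-≤ (allFin n) (λ w → sumOver-mono-≤ (upTo (suc T)) λ t′ →
             *-monoʳ-≤ (counted w t′) (sumOver-upTo-≤ (allFin K) (gap w t′) (u w v) _ λ j → capacity w v (suc t′ + j))) ⟩
      Ue I S T v t ∎
      where open ≤-Reasoning

    x̂-storage : loadH I x̂ v t ≤ bCap I S T v t
    x̂-storage = begin
      loadH I x̂ v t                                            ≤⟨ sumOver-mono-≤ (allFin K) charge ⟩
      sumOver (allFin K) (λ k → waiting k + inTransit k)       ≡⟨ sumOver-+ (allFin K) waiting inTransit ⟩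
      sumOver (allFin K) waiting + sumOver (allFin K) inTransit ≤⟨ +-mono-≤ (storage v (pred (next v t))) inTransit≤Ue ⟩
      b v + Ue I S T v t                                       ≤⟨ +-monoˡ-≤ (Ue I S T v t) b≤ ⟩
      bCap I S T v t                                           ∎
      where
      open ≤-Reasoning
      b≤ : b v ≤ (if S v (suc t) then b v else 2 * b v)
      b≤ with S v (suc t)
      ... | true  = ≤-refl
      ... | false = m≤m+n (b v) (b v + 0)

  module Flow (k : Fin K) (v : Fin n) (t : ℕ) where
    p : TimedNode
    p = v , t

    entering-unique : ∀ {a a′} → a ∈ path k → arcHead a ≡ p → a′ ∈ path k → arcHead a′ ≡ p → a ≡ a′
    entering-unique a∈ ha a′∈ ha′ = Simple-head-injective (path-Simple k) a∈ a′∈ (trans ha (sym ha′))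

    holdIn : ℕ → ℕ
    holdIn t″ = χ (S v t″ ∧ (t″ <ᵇ T) ∧ (nS I S T v t″ ≡ᵇ t) ∧ x̂ k (hold v t″))

    moveIn : Fin n → ℕ → ℕ
    moveIn w t″ = χ (S w t″ ∧ edge w v ∧ (prevS I S v (t″ + τ w v) ≡ᵇ t) ∧ x̂ k (move w v t″))

    holdIn-pos : ∀ t″ → 0 < holdIn t″ → hold v t″ ∈ path k × arcHead (hold v t″) ≡ p
    holdIn-pos t″ pos = x̂-true⇒∈ k _ (∧-trueʳ {nS I S T v t″ ≡ᵇ t} cond′) ,
                        cong (v ,_) (≡ᵇ-true⇒≡ _ _ (∧-trueˡ {nS I S T v t″ ≡ᵇ t} cond′))
      where cond′ = ∧-trueʳ {t″ <ᵇ T} (∧-trueʳ {S v t″} (χ-pos _ pos))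

    moveIn-pos : ∀ w t″ → 0 < moveIn w t″ → move w v t″ ∈ path k × arcHead (move w v t″) ≡ p
    moveIn-pos w t″ pos = x̂-true⇒∈ k _ (∧-trueʳ {prevS I S v (t″ + τ w v) ≡ᵇ t} cond′) ,
                          cong (v ,_) (≡ᵇ-true⇒≡ _ _ (∧-trueˡ {prevS I S v (t″ + τ w v) ≡ᵇ t} cond′))
      where cond′ = ∧-trueʳ {edge w v} (∧-trueʳ {S w t″} (χ-pos _ pos))

    holdsIn = ΣT T holdIn
    movesIn = ΣF (λ w → ΣT T (moveIn w))

    inflow-¬Enters : ¬ Enters p (path k) → inflow I S T x̂ k v t ≡ 0
    inflow-¬Enters ¬enters =
      cong₂ _+_ (sumOver-zero (upTo (suc T)) holdIn λ t″ _ → ¬0<⇒≡0 λ pos → ¬enters (uncurry lose (holdIn-pos t″ pos)))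
                (sumOver-zero (allFin n) _ λ w _ → sumOver-zero (upTo (suc T)) (moveIn w) λ t″ _ →
                   ¬0<⇒≡0 λ pos → ¬enters (uncurry lose (moveIn-pos w t″ pos)))

    holdsIn≤1 : holdsIn ≤ 1
    holdsIn≤1 = sumOver-≤-single (upTo (suc T)) holdIn 1 (upTo⁺ _) (λ _ → χ≤1 _) λ t₁ t₂ pos₁ pos₂ →
      cong arcTime (uncurry (uncurry entering-unique (holdIn-pos t₁ pos₁)) (holdIn-pos t₂ pos₂))

    movesIn≤1 : movesIn ≤ 1
    movesIn≤1 = sumOver-≤-single (allFin n) (λ w → ΣT T (moveIn w)) 1 (allFin⁺ n) movesFrom≤1 sameTail
      where
      movesFrom≤1 : ∀ w → ΣT T (moveIn w) ≤ 1
      movesFrom≤1 w = sumOver-≤-single (upTo (suc T)) (moveIn w) 1 (upTo⁺ _) (λ _ → χ≤1 _) λ t₁ t₂ pos₁ pos₂ →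
        cong arcTime (uncurry (uncurry entering-unique (moveIn-pos w t₁ pos₁)) (moveIn-pos w t₂ pos₂))
      sameTail : ∀ w w′ → 0 < ΣT T (moveIn w) → 0 < ΣT T (moveIn w′) → w ≡ w′
      sameTail w w′ pos pos′ with sumOver-pos (upTo (suc T)) (moveIn w) pos | sumOver-pos (upTo (suc T)) (moveIn w′) pos′
      ... | t₁ , _ , pos₁ | t₂ , _ , pos₂ =
        cong arcFrom (uncurry (uncurry entering-unique (moveIn-pos w t₁ pos₁)) (moveIn-pos w′ t₂ pos₂))

    holdsIn-pos⇒movesIn≡0 : 0 < holdsIn → movesIn ≡ 0
    holdsIn-pos⇒movesIn≡0 pos with sumOver-pos (upTo (suc T)) holdIn pos
    ... | t₁ , _ , pos₁ = sumOver-zero (allFin n) _ λ w _ → sumOver-zero (upTo (suc T)) (moveIn w) λ t₂ _ →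
      ¬0<⇒≡0 λ pos₂ → hold≢move (uncurry (uncurry entering-unique (holdIn-pos t₁ pos₁)) (moveIn-pos w t₂ pos₂))

    inflow≤1 : inflow I S T x̂ k v t ≤ 1
    inflow≤1 with holdsIn in holds≡
    ... | zero  = movesIn≤1
    ... | suc _ = subst (λ m → m + movesIn ≤ 1) holds≡
                    (subst (λ m → holdsIn + m ≤ 1) (sym (holdsIn-pos⇒movesIn≡0 (subst (0 <_) (sym holds≡) (s≤s z≤n))))
                      (subst (_≤ 1) (sym (+-identityʳ holdsIn)) holdsIn≤1))

    inflow≥1 : Enters p (path k) → 1 ≤ inflow I S T x̂ k v t
    inflow≥1 enters with find enters
    ... | hold _ t″ , a∈ , refl = ≤-trans (≤-trans (≤-reflexive (sym (χ-true term≡true)))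
                                    (∈⇒≤sumOver (upTo (suc T)) holdIn (∈-upTo⁺ (s≤s (S≤T v t″ (∧-trueˡ {S v t″} inArc))))))
                                    (m≤m+n holdsIn movesIn)
      where
      inArc = x̂-support k _ (∈⇒x̂-true k _ a∈)
      term≡true = ∧-true (∧-trueˡ {S v t″} inArc) (∧-true (∧-trueʳ {S v t″} inArc)
                    (∧-true (≡⇒≡ᵇ-true (next v t″) _ refl) (∈⇒x̂-true k _ a∈)))
    ... | move w _ t″ , a∈ , refl = ≤-trans (≤-trans (≤-reflexive (sym (χ-true term≡true)))
                                      (≤-trans (∈⇒≤sumOver (upTo (suc T)) (moveIn w) (∈-upTo⁺ (s≤s (S≤T w t″ (∧-trueˡ {S w t″} inArc)))))
                                               (∈⇒≤sumOver (allFin n) (λ w′ → ΣT T (moveIn w′)) (∈-allFin w))))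
                                      (m≤n+m movesIn holdsIn)
      where
      inArc = x̂-support k _ (∈⇒x̂-true k _ a∈)
      term≡true = ∧-true (∧-trueˡ {S w t″} inArc) (∧-true (∧-trueʳ {S w t″} inArc)
                    (∧-true (≡⇒≡ᵇ-true (prev v (t″ + τ w v)) _ refl) (∈⇒x̂-true k _ a∈)))

    inflow-Enters : Enters p (path k) → inflow I S T x̂ k v t ≡ 1
    inflow-Enters enters = ≤-antisym inflow≤1 (inflow≥1 enters)

    leaving-unique : ∀ {a a′} → a ∈ path k → a′ ∈ path k → arcTail a ≡ arcTail a′ → a ≡ a′
    leaving-unique = Simple-tail-injective (path-Walk k) (path-Simple k)

    outflow-¬Leaves : ¬ Leaves p (path k) → outflow I x̂ k v t ≡ 0
    outflow-¬Leaves ¬leaves =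
      cong₂ _+_ (¬0<⇒≡0 λ pos → ¬leaves (lose (x̂-true⇒∈ k _ (χ-pos _ pos)) refl))
                (sumOver-zero (allFin n) _ λ w _ → ¬0<⇒≡0 λ pos → ¬leaves (lose (x̂-true⇒∈ k _ (χ-pos _ pos)) refl))

    outflow≤1 : outflow I x̂ k v t ≤ 1
    outflow≤1 with x̂ k (hold v t) in held
    ... | true  = subst (λ m → 1 + m ≤ 1) (sym movesOut≡0) ≤-refl
      where
      movesOut≡0 : ΣF (λ w → χ (x̂ k (move v w t))) ≡ 0
      movesOut≡0 = sumOver-zero (allFin n) _ λ w _ → ¬0<⇒≡0 λ pos →
        hold≢move (leaving-unique (x̂-true⇒∈ k _ held) (x̂-true⇒∈ k _ (χ-pos _ pos)) refl)
    ... | false = sumOver-≤-single (allFin n) _ 1 (allFin⁺ n) (λ _ → χ≤1 _) λ w w′ pos pos′ →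
      cong arcTo (leaving-unique (x̂-true⇒∈ k _ (χ-pos _ pos)) (x̂-true⇒∈ k _ (χ-pos _ pos′)) refl)
      where
      arcTo : SArc I → Fin n
      arcTo (hold _ _)   = v
      arcTo (move _ w _) = w

    outflow≥1 : Leaves p (path k) → 1 ≤ outflow I x̂ k v t
    outflow≥1 leaves with find leaves
    ... | hold _ _ , a∈ , refl = ≤-trans (≤-reflexive (sym (χ-true (∈⇒x̂-true k _ a∈)))) (m≤m+n _ _)
    ... | move _ w _ , a∈ , refl = ≤-trans (≤-trans (≤-reflexive (sym (χ-true (∈⇒x̂-true k _ a∈))))
                                     (∈⇒≤sumOver (allFin n) (λ w′ → χ (x̂ k (move v w′ t))) (∈-allFin w)))
                                     (m≤n+m _ _)

    outflow-Leaves : Leaves p (path k) → outflow I x̂ k v t ≡ 1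
    outflow-Leaves leaves = ≤-antisym outflow≤1 (outflow≥1 leaves)

    atNode-yes : ∀ a m → p ≡ (a , m) → χ (_=F_ I a v ∧ (t ≡ᵇ m)) ≡ 1
    atNode-yes a m refl = χ-true (∧-true (=F-refl I v) (≡⇒≡ᵇ-true t t refl))

    atNode-no : ∀ a m → p ≢ (a , m) → χ (_=F_ I a v ∧ (t ≡ᵇ m)) ≡ 0
    atNode-no a m p≢ with a ≟ᶠ v | t ≡ᵇ m in t≡m
    ... | no _     | _     = refl
    ... | yes refl | true  = ⊥-elim (p≢ (cong (a ,_) (≡ᵇ-true⇒≡ t m t≡m)))
    ... | yes refl | false = refl

    x̂-flow : outflow I x̂ k v t + isSink I T k v t ≡ inflow I S T x̂ k v t + isSource I k v t
    x̂-flow with p ≟ᴺ (src k , 0) | p ≟ᴺ (dst k , T)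
    ... | yes p≡s | yes p≡e = cong₂ _+_ (trans (outflow-¬Leaves ¬leaves) (sym (inflow-¬Enters ¬enters)))
                                        (trans (atNode-yes (dst k) T p≡e) (sym (atNode-yes (src k) 0 p≡s)))
      where
      ¬leaves = subst (λ q → ¬ Leaves q (path k)) (sym p≡e) (Simple-¬Leaves-target (path-Walk k) (path-Simple k))
      ¬enters = subst (λ q → ¬ Enters q (path k)) (sym p≡s) (Simple-¬Enters-source (path-Simple k))
    ... | yes p≡s | no p≢e = trans (cong₂ _+_ (outflow-Leaves leaves) (atNode-no (dst k) T p≢e))
                                   (sym (cong₂ _+_ (inflow-¬Enters ¬enters) (atNode-yes (src k) 0 p≡s)))
      where
      leaves = subst (λ q → Leaves q (path k)) (sym p≡s) (Walk-leaves (path-Walk k) λ s≡e → p≢e (trans p≡s s≡e))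
      ¬enters = subst (λ q → ¬ Enters q (path k)) (sym p≡s) (Simple-¬Enters-source (path-Simple k))
    ... | no p≢s | yes p≡e = trans (cong₂ _+_ (outflow-¬Leaves ¬leaves) (atNode-yes (dst k) T p≡e))
                                   (sym (cong₂ _+_ (inflow-Enters enters) (atNode-no (src k) 0 p≢s)))
      where
      ¬leaves = subst (λ q → ¬ Leaves q (path k)) (sym p≡e) (Simple-¬Leaves-target (path-Walk k) (path-Simple k))
      enters = subst (λ q → Enters q (path k)) (sym p≡e) (Walk-enters (path-Walk k) λ s≡e → p≢s (trans p≡e (sym s≡e)))
    ... | no p≢s | no p≢e with any? (λ a → arcTail a ≟ᴺ p) (path k)
    ...   | yes leaves = cong₂ _+_ (trans (outflow-Leaves leaves) (sym (inflow-Enters (Walk-Leaves⇒Enters (path-Walk k) p≢s leaves))))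
                                   (trans (atNode-no (dst k) T p≢e) (sym (atNode-no (src k) 0 p≢s)))
    ...   | no ¬leaves = cong₂ _+_ (trans (outflow-¬Leaves ¬leaves) (sym (inflow-¬Enters (¬leaves ∘ Walk-Enters⇒Leaves (path-Walk k) p≢e))))
                                   (trans (atNode-no (dst k) T p≢e) (sym (atNode-no (src k) 0 p≢s)))

  x̂-feasible : FeasibleS I S T x̂ T*
  x̂-feasible = record
    { support  = x̂-support
    ; flow     = λ k v t _ → Flow.x̂-flow k v t
    ; moveTime = x̂-moveTime
    ; arrTime  = x̂-arrTime
    ; capacity = λ v w t _ → x̂-capacity v w t
    ; storage  = λ v t _ → Storage.x̂-storage v t
    }

proposition1 : (I : Instance) →
    (∀ v → Instance.edge I v v ≡ false) →
    (T* T : ℕ) → IsMinMakespan I T* → T* ≤ T →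
    (S : TimedSet I) →
    (∀ v t → S v t ≡ true → t ≤ T) →
    (∀ v → S v 0 ≡ true) → (∀ v → S v T ≡ true) →
    (x : SSol I) (T̂ : ℕ) → OptimalS I S T x T̂ →
    ∀ z t → Adds I S T x z t → S z t ≡ false → t ≤ suc T*
-- The bound holds for every prescribed node, new or not, and needs no assumption on loops.
proposition1 I _ T* T ((routing , routingFeasible , arrival≤T*) , _) T*≤T S S≤T S-0 S-T x T̂ (xFeasible , optimal) z t added _ =
  begin
    t       ≤⟨ AddedNodesBound.added⇒≤1+T̂ I S T S-0 S-T x T̂ xFeasible z t added ⟩
    suc T̂   ≤⟨ s≤s (optimal R.x̂ T* R.x̂-feasible) ⟩
    suc T*  ∎
  where
  open ≤-Reasoning
  module R = Relaxation I S T S-0 S-T S≤T T* T*≤T routing routingFeasible arrival≤T*
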